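{- Let $\mathcal{M}$ be a $\sqrt[6]{1}$-matroid of rank $r$ on ground set $E$, $|E|=n$, $M$ an $r\times n$ $\mathbb{H}$-matrix representing $\mathcal{M}$, and let $i,j\in E$ be distinct. Then: (1) the map $B\mapsto (B\setminus\{i\})\cup\{j\}$ is a bijection from $\{B\text{ basis}: i\in B,\ f_B(i)[j]\neq0\}$ to $\{B\text{ basis}: j\in B,\ f_B(j)[i]\neq0\}$; (2) if $B$ is a basis with $i\in B$ and $f_B(i)[j]\neq0$, then $f_B(i)[j]$ and $f_{(B\setminus\{i\})\cup\{j\}}(j)[i]$ are complex conjugates of each other.
   Context: $\mathbb{H}=\{z\in\mathbb{C}:z^6=1\}\cup\{0\}$; an $\mathbb{H}$-matrix is a complex matrix all of whose square subdeterminants lie in $\mathbb{H}$; it represents $\mathcal{M}$ if independent sets correspond to linearly independent column sets over $\mathbb{C}$ (columns indexed by $E$). For $J\subseteq E$, $M[J]$ is the submatrix of columns indexed by $J$; for a vector $v$ indexed by $E$, $v[j]$ is its $j$-th entry. For a basis $B$, $M_B=(M[B])^{ -1}M$ (so $M_B[B]$ is the identity), and for $e\in B$, $f_B(e)$ is the row of $M_B$ whose entry in column $e$ equals $1$. -}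

module Defs where

open import Data.Nat using (ℕ; zero; suc)
open import Data.Integer as ℤ using (ℤ; +_; -[1+_])
open import Data.Fin using (Fin; zero; suc; punchIn; _<_)
open import Data.Fin.Subset using (Subset; _∈_; _∉_; _-_; _∪_; ⁅_⁆; ∣_∣)
open import Relation.Nullary using (¬_)
open import Data.Product using (_×_; ∃; _,_)
open import Relation.Binary.PropositionalEquality using (_≡_; _≢_)

-- Eisenstein integers ℤ[ω] ⊂ ℂ, ω = e^{2πi/3}, ω² = -1 - ω.
-- mk a b  represents  a + b ω.  Every element of ℍ lies here.

record ℤω : Set where
  constructor mk
  field
    re : ℤ
    om : ℤ

0ω 1ω : ℤω
0ω = mk (+ 0) (+ 0)
1ω = mk (+ 1) (+ 0)

infixl 6 _+ω_
infixl 7 _*ω_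

_+ω_ : ℤω → ℤω → ℤω
mk a b +ω mk c d = mk (a ℤ.+ c) (b ℤ.+ d)

-ω_ : ℤω → ℤω
-ω mk a b = mk (ℤ.- a) (ℤ.- b)

_*ω_ : ℤω → ℤω → ℤω
mk a b *ω mk c d = mk (a ℤ.* c ℤ.- b ℤ.* d) (a ℤ.* d ℤ.+ b ℤ.* c ℤ.- b ℤ.* d)

-- complex conjugation: conj ω = ω² = -1 - ω, so conj (a + bω) = (a - b) - bω
conj : ℤω → ℤω
conj (mk a b) = mk (a ℤ.- b) (ℤ.- b)

-- ℍ = {z : z⁶ = 1} ∪ {0} = {0, ±1, ±ω, ±ω²}  (ω² = -1 - ω)
data Inℍ : ℤω → Set where
  h0   : Inℍ (mk (+ 0) (+ 0))
  h1   : Inℍ (mk (+ 1) (+ 0))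
  h-1  : Inℍ (mk -[1+ 0 ] (+ 0))
  hω   : Inℍ (mk (+ 0) (+ 1))
  h-ω  : Inℍ (mk (+ 0) -[1+ 0 ])
  hω²  : Inℍ (mk -[1+ 0 ] -[1+ 0 ])
  h-ω² : Inℍ (mk (+ 1) (+ 1))

Σ[_] : ∀ {n} → (Fin n → ℤω) → ℤω
Σ[_] {zero}  f = 0ω
Σ[_] {suc n} f = f zero +ω Σ[ (λ k → f (suc k)) ]

altΣ : ∀ {n} → (Fin n → ℤω) → ℤω
altΣ {zero}  f = 0ω
altΣ {suc n} f = f zero +ω (-ω altΣ (λ k → f (suc k)))

Matrix : ℕ → ℕ → Set
Matrix m n = Fin m → Fin n → ℤω

det : ∀ {k} → Matrix k k → ℤω
det {zero}  A = 1ω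
det {suc k} A = altΣ (λ c → A zero c *ω det (λ a b → A (suc a) (punchIn c b)))

StrictlyIncreasing : ∀ {k m} → (Fin k → Fin m) → Set
StrictlyIncreasing ρ = ∀ a b → a < b → ρ a < ρ b

IsℍMatrix : ∀ {r n} → Matrix r n → Set
IsℍMatrix {r} {n} M =
  ∀ k (ρ : Fin k → Fin r) (κ : Fin k → Fin n) →
  StrictlyIncreasing ρ → StrictlyIncreasing κ →
  Inℍ (det (λ a b → M (ρ a) (κ b)))

combo : ∀ {r n} → Matrix r n → (Fin n → ℤω) → Fin r → ℤω
combo M c x = Σ[ (λ e → c e *ω M x e) ]

SupportedOn : ∀ {n} → Subset n → (Fin n → ℤω) → Set
SupportedOn S c = ∀ e → e ∉ S → c e ≡ 0ω

Independent : ∀ {r n} → Matrix r n → Subset n → Set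
Independent M S =
  ∀ c → SupportedOn S c → (∀ x → combo M c x ≡ 0ω) → ∀ e → c e ≡ 0ω

IsBasis : ∀ {r n} → Matrix r n → Subset n → Set
IsBasis M B = Independent M B × (∀ e → e ∉ B → ¬ Independent M (B ∪ ⁅ e ⁆))

HasRank : ∀ {r n} → Matrix r n → ℕ → Set
HasRank M r = ∃ λ B → IsBasis M B × ∣ B ∣ ≡ r

-- c is column j of M_B = M[B]⁻¹ M, indexed by the elements of B:
-- M[j] = Σ_{b ∈ B} c b · M[b].  Hence f_B(i)[j] = c i for i ∈ B.
IsColOfMB : ∀ {r n} → Matrix r n → Subset n → Fin n → (Fin n → ℤω) → Set
IsColOfMB M B j c = SupportedOn B c × (∀ x → combo M c x ≡ M x j)

fB≡ : ∀ {r n} → Matrix r n → Subset n → Fin n → Fin n → ℤω → Set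
fB≡ M B i j z = ∃ λ c → IsColOfMB M B j c × c i ≡ z

Good : ∀ {r n} → Matrix r n → Fin n → Fin n → Subset n → Set
Good M i j B = IsBasis M B × i ∈ B × (∃ λ z → fB≡ M B i j z × z ≢ 0ω)

exch : ∀ {n} → Fin n → Fin n → Subset n → Subset n
exch i j B = (B - i) ∪ ⁅ j ⁆

-- Write c for the column of M_B indexed by j, so that M[j] = Σ_{b ∈ B} c_b M[b] and f_B(i)[j] = c_i.
-- The entries of M lie in the Eisenstein integers ℤ[ω], an integral domain containing ℍ, and the
-- vector c - δ_j is a circuit through i when c_i ≠ 0; hence B' = (B - i) ∪ {j} is again a basis.
-- All bases have r elements, so M[B] is square, and by Cramer's rule det M[B'] = ± c_i · det M[B]
-- (up to sorting the columns). Both determinants are nonzero elements of ℍ, i.e. units, so c_i has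
-- an inverse w, and w · (c_i δ_i - (c - δ_j)) is the column of M_{B'} indexed by i, with entry w
-- at j. This proves (1), the inverse map being the exchange back. For (2), uniqueness of
-- coordinates gives f_B(i)[j] · f_{B'}(j)[i] = 1, and every unit of ℤ[ω] has norm 1, so its
-- inverse is its conjugate.

module Submission where

open import Defs
open import Algebra.Bundles using (CommutativeRing)
open import Algebra.Structures using (IsCommutativeRing)
open import Data.Empty using (⊥; ⊥-elim)
open import Data.Fin using (Fin; zero; suc; punchIn; punchOut; toℕ; inject₁)
open import Data.Fin.Permutation.Components using (transpose; transpose-inverse)
open import Data.Fin.Properties
  using ( _≟_; <-cmp; all?; ¬∀⟶∃¬; suc-injective; toℕ-injective; toℕ-inject₁; toℕ<n
        ; punchInᵢ≢i; punchIn-injective; punchIn-punchOut )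
open import Data.Fin.Subset as Sub using (Subset; _∈_; _∉_; _⊆_; _∪_; ⁅_⁆; ∣_∣; inside; outside)
open import Data.Fin.Subset.Properties
  using (_∈?_; drop-there; x∈p∪q⁻; x∈p∪q⁺; x∈⁅y⁆⇒x≡y; x∈⁅x⁆; x∈p∧x≢y⇒x∈p-y; p─q⊆p; ⊆-antisym)
open import Data.Integer as ℤ using (ℤ; +_; -[1+_]; 0ℤ)
import Data.Integer.Properties as ℤₚ
import Data.Integer.Tactic.RingSolver as ℤ-Solver
open import Data.Nat as ℕ using (ℕ; zero; suc)
import Data.Nat.Properties as ℕₚ
import Data.Nat.Tactic.RingSolver as ℕ-Solver
open import Data.Product using (∃; ∃₂; _×_; _,_; proj₁; proj₂)
open import Data.Sum as Sum using (_⊎_; inj₁; inj₂; [_,_]′)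
open import Data.Vec using (_∷_; []; here; there)
open import Data.Vec.Functional using (map; removeAt; insertAt; updateAt)
open import Data.Vec.Functional.Properties
  using (insertAt-lookup; insertAt-punchIn; updateAt-updates; updateAt-minimal)
open import Function using (_∘_)
open import Function.Definitions using (Injective)
open import Level using (0ℓ)
open import Relation.Binary.Definitions using (tri<; tri≈; tri>)
open import Relation.Binary.PropositionalEquality
open import Relation.Nullary using (¬_; Dec; yes; no; map′)
open import Relation.Nullary.Decidable using (_×-dec_; dec-true; dec-false; dec⇒maybe)
open import Tactic.RingSolver using (solve-∀)
import Tactic.RingSolver.Core.AlmostCommutativeRing as ACR

-- The Eisenstein integers ℤ[ω]

module _ where
  open import Data.Integer using (_+_; _*_; _-_; -_)

  +ω-comm : ∀ x y → x +ω y ≡ y +ω x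
  +ω-comm (mk a b) (mk c d) = cong₂ mk (ℤₚ.+-comm a c) (ℤₚ.+-comm b d)

  +ω-assoc : ∀ x y z → (x +ω y) +ω z ≡ x +ω (y +ω z)
  +ω-assoc (mk a b) (mk c d) (mk e f) = cong₂ mk (ℤₚ.+-assoc a c e) (ℤₚ.+-assoc b d f)

  +ω-identityˡ : ∀ x → 0ω +ω x ≡ x
  +ω-identityˡ (mk a b) = cong₂ mk (ℤₚ.+-identityˡ a) (ℤₚ.+-identityˡ b)

  +ω-identityʳ : ∀ x → x +ω 0ω ≡ x
  +ω-identityʳ (mk a b) = cong₂ mk (ℤₚ.+-identityʳ a) (ℤₚ.+-identityʳ b)

  -ω-inverseˡ : ∀ x → (-ω x) +ω x ≡ 0ω
  -ω-inverseˡ (mk a b) = cong₂ mk (ℤₚ.+-inverseˡ a) (ℤₚ.+-inverseˡ b)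

  -ω-inverseʳ : ∀ x → x +ω (-ω x) ≡ 0ω
  -ω-inverseʳ (mk a b) = cong₂ mk (ℤₚ.+-inverseʳ a) (ℤₚ.+-inverseʳ b)

  *ω-comm : ∀ x y → x *ω y ≡ y *ω x
  *ω-comm (mk a b) (mk c d) = cong₂ mk (re a b c d) (om a b c d)
    where
    re : ∀ a b c d → a * c - b * d ≡ c * a - d * b
    re = ℤ-Solver.solve-∀
    om : ∀ a b c d → a * d + b * c - b * d ≡ c * b + d * a - d * b
    om = ℤ-Solver.solve-∀

  *ω-assoc : ∀ x y z → (x *ω y) *ω z ≡ x *ω (y *ω z)
  *ω-assoc (mk a b) (mk c d) (mk e f) = cong₂ mk (re a b c d e f) (om a b c d e f)
    where
    re : ∀ a b c d e f → (a * c - b * d) * e - (a * d + b * c - b * d) * f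
                       ≡ a * (c * e - d * f) - b * (c * f + d * e - d * f)
    re = ℤ-Solver.solve-∀
    om : ∀ a b c d e f →
         (a * c - b * d) * f + (a * d + b * c - b * d) * e - (a * d + b * c - b * d) * f
       ≡ a * (c * f + d * e - d * f) + b * (c * e - d * f) - b * (c * f + d * e - d * f)
    om = ℤ-Solver.solve-∀

  *ω-identityˡ : ∀ x → 1ω *ω x ≡ x
  *ω-identityˡ (mk a b) = cong₂ mk (re a b) (om a b)
    where
    re : ∀ a b → + 1 * a - + 0 * b ≡ a
    re = ℤ-Solver.solve-∀
    om : ∀ a b → + 1 * b + + 0 * a - + 0 * b ≡ b
    om = ℤ-Solver.solve-∀

  *ω-distribʳ : ∀ x y z → (y +ω z) *ω x ≡ (y *ω x) +ω (z *ω x)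
  *ω-distribʳ (mk a b) (mk c d) (mk e f) = cong₂ mk (re a b c d e f) (om a b c d e f)
    where
    re : ∀ a b c d e f → (c + e) * a - (d + f) * b ≡ (c * a - d * b) + (e * a - f * b)
    re = ℤ-Solver.solve-∀
    om : ∀ a b c d e f → (c + e) * b + (d + f) * a - (d + f) * b
                       ≡ (c * b + d * a - d * b) + (e * b + f * a - f * b)
    om = ℤ-Solver.solve-∀

ℤω-isCommutativeRing : IsCommutativeRing _≡_ _+ω_ _*ω_ -ω_ 0ω 1ω
ℤω-isCommutativeRing = record
  { isRing = record
    { +-isAbelianGroup = record
      { isGroup = record
        { isMonoid = record
          { isSemigroup = record
            { isMagma = record { isEquivalence = isEquivalence ; ∙-cong = cong₂ _+ω_ }
            ; assoc = +ω-assoc }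
          ; identity = +ω-identityˡ , +ω-identityʳ }
        ; inverse = -ω-inverseˡ , -ω-inverseʳ
        ; ⁻¹-cong = cong -ω_ }
      ; comm = +ω-comm }
    ; *-cong = cong₂ _*ω_
    ; *-assoc = *ω-assoc
    ; *-identity = *ω-identityˡ , (λ x → trans (*ω-comm x 1ω) (*ω-identityˡ x))
    ; distrib = (λ x y z → trans (*ω-comm x (y +ω z))
                             (trans (*ω-distribʳ x y z) (cong₂ _+ω_ (*ω-comm y x) (*ω-comm z x))))
              , *ω-distribʳ }
  ; *-comm = *ω-comm }

ℤω-commutativeRing : CommutativeRing 0ℓ 0ℓ
ℤω-commutativeRing = record { isCommutativeRing = ℤω-isCommutativeRing }

open CommutativeRing ℤω-commutativeRing
  using () renaming (zeroˡ to *ω-zeroˡ; zeroʳ to *ω-zeroʳ; *-identityʳ to *ω-identityʳ)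

infix 4 _≟ω_
_≟ω_ : (x y : ℤω) → Dec (x ≡ y)
mk a b ≟ω mk c d =
  map′ (λ (p , q) → cong₂ mk p q) (λ e → cong ℤω.re e , cong ℤω.om e) (a ℤₚ.≟ c ×-dec b ℤₚ.≟ d)

ℤω-ring : ACR.AlmostCommutativeRing 0ℓ 0ℓ
ℤω-ring = ACR.fromCommutativeRing ℤω-commutativeRing (λ x → dec⇒maybe (0ω ≟ω x))

-ω≡0ω⇒≡0ω : ∀ a → -ω a ≡ 0ω → a ≡ 0ω
-ω≡0ω⇒≡0ω a -a≡0 = trans (neg-neg a) (cong -ω_ -a≡0)
  where
  neg-neg : ∀ a → a ≡ -ω (-ω a)
  neg-neg = solve-∀ ℤω-ring

module _ where
  open import Data.Integer using (_+_; _*_; _-_; -_)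

  norm : ℤω → ℤ
  norm (mk a b) = a * a - a * b + b * b

  *ω-conj : ∀ x → x *ω conj x ≡ mk (norm x) 0ℤ
  *ω-conj (mk a b) = cong₂ mk (re a b) (om a b)
    where
    re : ∀ a b → a * (a - b) - b * (- b) ≡ a * a - a * b + b * b
    re = ℤ-Solver.solve-∀
    om : ∀ a b → a * (- b) + b * (a - b) - b * (- b) ≡ + 0
    om = ℤ-Solver.solve-∀

  norm-* : ∀ x y → norm (x *ω y) ≡ norm x * norm y
  norm-* (mk a b) (mk c d) = lemma a b c d
    where
    lemma : ∀ a b c d →
        (a * c - b * d) * (a * c - b * d) - (a * c - b * d) * (a * d + b * c - b * d)
          + (a * d + b * c - b * d) * (a * d + b * c - b * d)
      ≡ (a * a - a * b + b * b) * (c * c - c * d + d * d)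
    lemma = ℤ-Solver.solve-∀

  private
    i*i≡+∣i∣*∣i∣ : ∀ i → i * i ≡ + (ℤ.∣ i ∣ ℕ.* ℤ.∣ i ∣)
    i*i≡+∣i∣*∣i∣ (+ n)    = ℤₚ.+◃n≡+n (n ℕ.* n)
    i*i≡+∣i∣*∣i∣ -[1+ n ] = ℤₚ.+◃n≡+n _

  four*norm : ∀ a b → + 4 * norm (mk a b)
                    ≡ + (ℤ.∣ + 2 * a - b ∣ ℕ.* ℤ.∣ + 2 * a - b ∣ ℕ.+ 3 ℕ.* (ℤ.∣ b ∣ ℕ.* ℤ.∣ b ∣))
  four*norm a b = begin
    + 4 * norm (mk a b)                               ≡⟨ complete-square a b ⟩
    (+ 2 * a - b) * (+ 2 * a - b) + + 3 * (b * b)     ≡⟨ cong₂ (λ u v → u + + 3 * v)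
                                                           (i*i≡+∣i∣*∣i∣ (+ 2 * a - b)) (i*i≡+∣i∣*∣i∣ b) ⟩
    + (P ℕ.* P) + + 3 * + (Q ℕ.* Q)                   ≡⟨ cong (λ t → + (P ℕ.* P) + t) (ℤₚ.pos-* 3 (Q ℕ.* Q)) ⟨
    + (P ℕ.* P) + + (3 ℕ.* (Q ℕ.* Q))                 ≡⟨ ℤₚ.pos-+ (P ℕ.* P) (3 ℕ.* (Q ℕ.* Q)) ⟨
    + (P ℕ.* P ℕ.+ 3 ℕ.* (Q ℕ.* Q))                   ∎
    where
    open ≡-Reasoning
    P = ℤ.∣ + 2 * a - b ∣
    Q = ℤ.∣ b ∣
    complete-square : ∀ a b → + 4 * (a * a - a * b + b * b)
                            ≡ (+ 2 * a - b) * (+ 2 * a - b) + + 3 * (b * b)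
    complete-square = ℤ-Solver.solve-∀

  norm-nonneg : ∀ x → 0ℤ ℤ.≤ norm x
  norm-nonneg (mk a b) = ℤₚ.*-cancelˡ-≤-pos 0ℤ (norm (mk a b)) (+ 4)
    (subst₂ ℤ._≤_ (sym (ℤₚ.*-zeroʳ (+ 4))) (sym (four*norm a b)) (ℤ.+≤+ ℕ.z≤n))

  norm≡0⇒≡0ω : ∀ x → norm x ≡ 0ℤ → x ≡ 0ω
  norm≡0⇒≡0ω (mk a b) N≡0 = cong₂ mk a≡0 b≡0
    where
    P = ℤ.∣ + 2 * a - b ∣
    Q = ℤ.∣ b ∣
    squares≡0 : P ℕ.* P ℕ.+ 3 ℕ.* (Q ℕ.* Q) ≡ 0
    squares≡0 = ℤₚ.+-injective (trans (sym (four*norm a b)) (trans (cong (+ 4 *_) N≡0) (ℤₚ.*-zeroʳ (+ 4))))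
    m*m≡0⇒m≡0 : ∀ m → m ℕ.* m ≡ 0 → m ≡ 0
    m*m≡0⇒m≡0 m eq = Sum.reduce (ℕₚ.m*n≡0⇒m≡0∨n≡0 m eq)
    b≡0 : b ≡ 0ℤ
    b≡0 = ℤₚ.∣i∣≡0⇒i≡0 (m*m≡0⇒m≡0 Q
        (ℕₚ.m*n≡0⇒m≡0 _ 3 (trans (ℕₚ.*-comm (Q ℕ.* Q) 3) (ℕₚ.m+n≡0⇒n≡0 (P ℕ.* P) squares≡0))))
    2a≡0 : + 2 * a ≡ 0ℤ
    2a≡0 = begin
      + 2 * a      ≡⟨ ℤₚ.+-identityʳ (+ 2 * a) ⟨
      + 2 * a - 0ℤ ≡⟨ cong (λ t → + 2 * a - t) b≡0 ⟨
      + 2 * a - b  ≡⟨ ℤₚ.∣i∣≡0⇒i≡0 (m*m≡0⇒m≡0 P (ℕₚ.m+n≡0⇒m≡0 (P ℕ.* P) squares≡0)) ⟩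
      0ℤ           ∎
      where open ≡-Reasoning
    a≡0 : a ≡ 0ℤ
    a≡0 = ℤₚ.*-cancelˡ-≡ (+ 2) a 0ℤ (trans 2a≡0 (sym (ℤₚ.*-zeroʳ (+ 2))))

xy≡0⇒x≡0∨y≡0 : ∀ x y → x *ω y ≡ 0ω → x ≡ 0ω ⊎ y ≡ 0ω
xy≡0⇒x≡0∨y≡0 x y xy≡0 = Sum.map (norm≡0⇒≡0ω x) (norm≡0⇒≡0ω y)
  (ℤₚ.i*j≡0⇒i≡0∨j≡0 (norm x) (trans (sym (norm-* x y)) (cong norm xy≡0)))

xy≡0∧x≢0⇒y≡0 : ∀ {x y} → x *ω y ≡ 0ω → x ≢ 0ω → y ≡ 0ω
xy≡0∧x≢0⇒y≡0 {x} {y} xy≡0 x≢0 = [ ⊥-elim ∘ x≢0 , (λ y≡0 → y≡0) ]′ (xy≡0⇒x≡0∨y≡0 x y xy≡0)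

-- Every unit of ℤ[ω] has norm 1, so its inverse is its conjugate.
xy≡1⇒x≡conj[y] : ∀ x y → x *ω y ≡ 1ω → x ≡ conj y
xy≡1⇒x≡conj[y] x y xy≡1 = begin
  x                   ≡⟨ *ω-identityʳ x ⟨
  x *ω 1ω             ≡⟨ cong (x *ω_) y*conj[y]≡1 ⟨
  x *ω (y *ω conj y)  ≡⟨ *ω-assoc x y (conj y) ⟨
  (x *ω y) *ω conj y  ≡⟨ cong (_*ω conj y) xy≡1 ⟩
  1ω *ω conj y        ≡⟨ *ω-identityˡ (conj y) ⟩
  conj y              ∎
  where
  open ≡-Reasoning
  nonneg : ∀ z → + ℤ.∣ norm z ∣ ≡ norm z
  nonneg z = ℤₚ.0≤i⇒+∣i∣≡i (norm-nonneg z)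
  ∣Nx∣*∣Ny∣≡1 : ℤ.∣ norm x ∣ ℕ.* ℤ.∣ norm y ∣ ≡ 1
  ∣Nx∣*∣Ny∣≡1 = trans (sym (ℤₚ.abs-* (norm x) (norm y)))
                 (cong ℤ.∣_∣ (trans (sym (norm-* x y)) (cong norm xy≡1)))
  y*conj[y]≡1 : y *ω conj y ≡ 1ω
  y*conj[y]≡1 = trans (*ω-conj y)
    (cong (λ t → mk t 0ℤ) (trans (sym (nonneg y))
      (cong +_ (ℕₚ.m*n≡1⇒n≡1 (ℤ.∣ norm x ∣) (ℤ.∣ norm y ∣) ∣Nx∣*∣Ny∣≡1))))

Inℍ-neg : ∀ {h} → Inℍ h → Inℍ (-ω h)
Inℍ-neg h0   = h0
Inℍ-neg h1   = h-1
Inℍ-neg h-1  = h1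
Inℍ-neg hω   = h-ω
Inℍ-neg h-ω  = hω
Inℍ-neg hω²  = h-ω²
Inℍ-neg h-ω² = hω²

Inℍ-*ω-conj : ∀ {h} → Inℍ h → h ≢ 0ω → h *ω conj h ≡ 1ω
Inℍ-*ω-conj h0   h≢0 = ⊥-elim (h≢0 refl)
Inℍ-*ω-conj h1   _   = refl
Inℍ-*ω-conj h-1  _   = refl
Inℍ-*ω-conj hω   _   = refl
Inℍ-*ω-conj h-ω  _   = refl
Inℍ-*ω-conj hω²  _   = refl
Inℍ-*ω-conj h-ω² _   = refl

-- Finite sums

open import Algebra.Properties.Semiring.Sum (CommutativeRing.semiring ℤω-commutativeRing)
  using (sum; sum-cong-≗; sum-remove; ∑-comm; ∑-distrib-+; *-distribˡ-sum; sum-replicate-zero)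

Σ≡sum : ∀ {n} (f : Fin n → ℤω) → Σ[ f ] ≡ sum f
Σ≡sum {zero}  f = refl
Σ≡sum {suc n} f = cong (f zero +ω_) (Σ≡sum (f ∘ suc))

Σ-cong : ∀ {n} {f g : Fin n → ℤω} → (∀ k → f k ≡ g k) → Σ[ f ] ≡ Σ[ g ]
Σ-cong {f = f} {g} f≗g = trans (Σ≡sum f) (trans (sum-cong-≗ f≗g) (sym (Σ≡sum g)))

Σ-zero : ∀ {n} (f : Fin n → ℤω) → (∀ k → f k ≡ 0ω) → Σ[ f ] ≡ 0ω
Σ-zero {n} f f≗0 = trans (Σ-cong f≗0) (trans (Σ≡sum _) (sum-replicate-zero n))

Σ-distrib-+ : ∀ {n} (f g : Fin n → ℤω) → Σ[ (λ k → f k +ω g k) ] ≡ Σ[ f ] +ω Σ[ g ]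
Σ-distrib-+ f g = begin
  Σ[ (λ k → f k +ω g k) ] ≡⟨ Σ≡sum _ ⟩
  sum (λ k → f k +ω g k)  ≡⟨ ∑-distrib-+ f g ⟩
  sum f +ω sum g          ≡⟨ cong₂ _+ω_ (Σ≡sum f) (Σ≡sum g) ⟨
  Σ[ f ] +ω Σ[ g ]        ∎
  where open ≡-Reasoning

*ω-distribˡ-Σ : ∀ {n} (a : ℤω) (f : Fin n → ℤω) → a *ω Σ[ f ] ≡ Σ[ (λ k → a *ω f k) ]
*ω-distribˡ-Σ a f = begin
  a *ω Σ[ f ]            ≡⟨ cong (a *ω_) (Σ≡sum f) ⟩
  a *ω sum f             ≡⟨ *-distribˡ-sum a f ⟩
  sum (map (a *ω_) f)    ≡⟨ Σ≡sum _ ⟨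
  Σ[ (λ k → a *ω f k) ]  ∎
  where open ≡-Reasoning

Σ-comm : ∀ {m n} (f : Fin m → Fin n → ℤω) →
         Σ[ (λ a → Σ[ (λ b → f a b) ]) ] ≡ Σ[ (λ b → Σ[ (λ a → f a b) ]) ]
Σ-comm f = begin
  Σ[ (λ a → Σ[ f a ]) ]                  ≡⟨ Σ-cong (λ a → Σ≡sum (f a)) ⟩
  Σ[ (λ a → sum (f a)) ]                 ≡⟨ Σ≡sum _ ⟩
  sum (λ a → sum (f a))                  ≡⟨ ∑-comm f ⟩
  sum (λ b → sum (λ a → f a b))          ≡⟨ Σ≡sum _ ⟨
  Σ[ (λ b → sum (λ a → f a b)) ]         ≡⟨ Σ-cong (λ b → Σ≡sum (λ a → f a b)) ⟨
  Σ[ (λ b → Σ[ (λ a → f a b) ]) ]        ∎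
  where open ≡-Reasoning

Σ-remove : ∀ {n} (f : Fin (suc n) → ℤω) (p : Fin (suc n)) → Σ[ f ] ≡ f p +ω Σ[ f ∘ punchIn p ]
Σ-remove f p = begin
  Σ[ f ]                    ≡⟨ Σ≡sum f ⟩
  sum f                     ≡⟨ sum-remove {i = p} f ⟩
  f p +ω sum (removeAt f p) ≡⟨ cong (f p +ω_) (Σ≡sum (f ∘ punchIn p)) ⟨
  f p +ω Σ[ f ∘ punchIn p ] ∎
  where open ≡-Reasoning

Σ-single : ∀ {n} (f : Fin n → ℤω) (p : Fin n) → (∀ k → k ≢ p → f k ≡ 0ω) → Σ[ f ] ≡ f p
Σ-single {suc n} f p f≡0 = begin
  Σ[ f ]                    ≡⟨ Σ-remove f p ⟩
  f p +ω Σ[ f ∘ punchIn p ] ≡⟨ cong (f p +ω_) (Σ-zero _ (λ k → f≡0 _ (punchInᵢ≢i p k))) ⟩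
  f p +ω 0ω                 ≡⟨ +ω-identityʳ (f p) ⟩
  f p                       ∎
  where open ≡-Reasoning

-- Determinants

altΣ-cong : ∀ {n} {f g : Fin n → ℤω} → (∀ k → f k ≡ g k) → altΣ f ≡ altΣ g
altΣ-cong {zero}  f≗g = refl
altΣ-cong {suc n} f≗g = cong₂ (λ a b → a +ω (-ω b)) (f≗g zero) (altΣ-cong (f≗g ∘ suc))

altΣ-zero : ∀ {n} (f : Fin n → ℤω) → (∀ k → f k ≡ 0ω) → altΣ f ≡ 0ω
altΣ-zero {zero}  f f≗0 = refl
altΣ-zero {suc n} f f≗0 = cong₂ (λ a b → a +ω (-ω b)) (f≗0 zero) (altΣ-zero (f ∘ suc) (f≗0 ∘ suc))

altΣ-linear : ∀ {n} (s t : ℤω) (f g : Fin n → ℤω) →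
              altΣ (λ k → s *ω f k +ω t *ω g k) ≡ s *ω altΣ f +ω t *ω altΣ g
altΣ-linear {zero}  s t f g = sym (cong₂ _+ω_ (*ω-zeroʳ s) (*ω-zeroʳ t))
altΣ-linear {suc n} s t f g =
  trans (cong (λ z → (s *ω f zero +ω t *ω g zero) +ω (-ω z)) (altΣ-linear s t (f ∘ suc) (g ∘ suc)))
        (regroup s t (f zero) (g zero) (altΣ (f ∘ suc)) (altΣ (g ∘ suc)))
  where
  regroup : ∀ s t a b c d → (s *ω a +ω t *ω b) +ω (-ω (s *ω c +ω t *ω d))
                          ≡ s *ω (a +ω (-ω c)) +ω t *ω (b +ω (-ω d))
  regroup = solve-∀ ℤω-ring

altΣ-single : ∀ {n} (f : Fin n → ℤω) (c : Fin n) → (∀ k → k ≢ c → f k ≡ 0ω) →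
              altΣ f ≡ f c ⊎ altΣ f ≡ -ω f c
altΣ-single {suc n} f zero f≡0 =
  inj₁ (trans (cong (λ z → f zero +ω -ω z) (altΣ-zero (f ∘ suc) (λ k → f≡0 (suc k) λ ())))
              (+ω-identityʳ (f zero)))
altΣ-single {suc n} f (suc c) f≡0 with altΣ-single (f ∘ suc) c (λ k k≢c → f≡0 (suc k) (k≢c ∘ suc-injective))
... | inj₁ eq = inj₂ (trans (cong₂ (λ u v → u +ω -ω v) (f≡0 zero λ ()) eq) (+ω-identityˡ (-ω f (suc c))))
... | inj₂ eq = inj₁ (trans (cong₂ (λ u v → u +ω -ω v) (f≡0 zero λ ()) eq) (0-neg-neg (f (suc c))))
  where
  0-neg-neg : ∀ a → 0ω +ω -ω (-ω a) ≡ a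
  0-neg-neg = solve-∀ ℤω-ring

minor : ∀ {k} → Fin (suc k) → Matrix (suc k) (suc k) → Matrix k k
minor c A x b = A (suc x) (punchIn c b)

det-cong : ∀ {k} {A B : Matrix k k} → (∀ x b → A x b ≡ B x b) → det A ≡ det B
det-cong {zero}  A≗B = refl
det-cong {suc k} A≗B =
  altΣ-cong (λ c → cong₂ _*ω_ (A≗B zero c) (det-cong (λ x b → A≗B (suc x) (punchIn c b))))

det-linear : ∀ {k} (A B C : Matrix k k) (p : Fin k) (s t : ℤω) →
  (∀ x b → b ≢ p → A x b ≡ C x b) → (∀ x b → b ≢ p → B x b ≡ C x b) →
  (∀ x → C x p ≡ s *ω A x p +ω t *ω B x p) → det C ≡ s *ω det A +ω t *ω det B
det-linear {suc k} A B C p s t A≗C B≗C Cp =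
  trans (altΣ-cong term) (altΣ-linear s t (λ c → A zero c *ω det (minor c A)) (λ c → B zero c *ω det (minor c B)))
  where
  term : ∀ c → C zero c *ω det (minor c C)
             ≡ s *ω (A zero c *ω det (minor c A)) +ω t *ω (B zero c *ω det (minor c B))
  term c with c ≟ p
  ... | yes refl = begin
    C zero c *ω det (minor c C)                         ≡⟨ cong (_*ω det (minor c C)) (Cp zero) ⟩
    (s *ω A zero c +ω t *ω B zero c) *ω det (minor c C) ≡⟨ distrib s t (A zero c) (B zero c) _ ⟩
    s *ω (A zero c *ω det (minor c C)) +ω t *ω (B zero c *ω det (minor c C))
      ≡⟨ cong₂ (λ u v → s *ω (A zero c *ω u) +ω t *ω (B zero c *ω v))
               (det-cong λ x b → sym (A≗C (suc x) (punchIn c b) (punchInᵢ≢i c b)))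
               (det-cong λ x b → sym (B≗C (suc x) (punchIn c b) (punchInᵢ≢i c b))) ⟩
    s *ω (A zero c *ω det (minor c A)) +ω t *ω (B zero c *ω det (minor c B)) ∎
    where
    open ≡-Reasoning
    distrib : ∀ s t a b u → (s *ω a +ω t *ω b) *ω u ≡ s *ω (a *ω u) +ω t *ω (b *ω u)
    distrib = solve-∀ ℤω-ring
  ... | no c≢p = begin
    C zero c *ω det (minor c C)                                   ≡⟨ cong (C zero c *ω_) minor-linear ⟩
    C zero c *ω (s *ω det (minor c A) +ω t *ω det (minor c B))    ≡⟨ distrib s t (C zero c) _ _ ⟩
    s *ω (C zero c *ω det (minor c A)) +ω t *ω (C zero c *ω det (minor c B))
      ≡⟨ cong₂ (λ u v → s *ω (u *ω det (minor c A)) +ω t *ω (v *ω det (minor c B)))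
               (sym (A≗C zero c c≢p)) (sym (B≗C zero c c≢p)) ⟩
    s *ω (A zero c *ω det (minor c A)) +ω t *ω (B zero c *ω det (minor c B)) ∎
    where
    open ≡-Reasoning
    distrib : ∀ s t a u v → a *ω (s *ω u +ω t *ω v) ≡ s *ω (a *ω u) +ω t *ω (a *ω v)
    distrib = solve-∀ ℤω-ring
    p′ = punchOut c≢p
    punchIn≢p : ∀ b → b ≢ p′ → punchIn c b ≢ p
    punchIn≢p b b≢p′ eq = b≢p′ (punchIn-injective c b p′ (trans eq (sym (punchIn-punchOut c≢p))))
    minor-linear : det (minor c C) ≡ s *ω det (minor c A) +ω t *ω det (minor c B)
    minor-linear = det-linear (minor c A) (minor c B) (minor c C) p′ s t
      (λ x b b≢p′ → A≗C (suc x) (punchIn c b) (punchIn≢p b b≢p′))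
      (λ x b b≢p′ → B≗C (suc x) (punchIn c b) (punchIn≢p b b≢p′))
      (λ x → subst (λ q → C (suc x) q ≡ s *ω A (suc x) q +ω t *ω B (suc x) q)
                   (sym (punchIn-punchOut c≢p)) (Cp (suc x)))

det-additive : ∀ {k} (A B C : Matrix k k) (p : Fin k) →
  (∀ x b → b ≢ p → A x b ≡ C x b) → (∀ x b → b ≢ p → B x b ≡ C x b) →
  (∀ x → C x p ≡ A x p +ω B x p) → det C ≡ det A +ω det B
det-additive A B C p A≗C B≗C Cp =
  trans (det-linear A B C p 1ω 1ω A≗C B≗C (λ x → trans (Cp x) (sym (1*+1* (A x p) (B x p)))))
        (1*+1* (det A) (det B))
  where
  1*+1* : ∀ a b → 1ω *ω a +ω 1ω *ω b ≡ a +ω b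
  1*+1* a b = cong₂ _+ω_ (*ω-identityˡ a) (*ω-identityˡ b)

data Adjacent : ∀ {k} → Fin k → Fin k → Set where
  first : ∀ {k} → Adjacent {suc (suc k)} zero (suc zero)
  next : ∀ {k} {p q : Fin k} → Adjacent p q → Adjacent (suc p) (suc q)

inject₁-Adjacent : ∀ {k} (t : Fin k) → Adjacent (inject₁ t) (suc t)
inject₁-Adjacent zero    = first
inject₁-Adjacent (suc t) = next (inject₁-Adjacent t)

Adjacent⇒toℕ≡suc : ∀ {k} {p q : Fin k} → Adjacent p q → toℕ q ≡ suc (toℕ p)
Adjacent⇒toℕ≡suc first    = refl
Adjacent⇒toℕ≡suc (next a) = cong suc (Adjacent⇒toℕ≡suc a)

Adjacent⇒≢ : ∀ {k} {p q : Fin k} → Adjacent p q → p ≢ q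
Adjacent⇒≢ a p≡q = ℕₚ.1+n≢n (sym (trans (cong toℕ p≡q) (Adjacent⇒toℕ≡suc a)))

Adjacent-punchIn : ∀ {k} {p q : Fin (suc k)} → Adjacent p q → (c : Fin (suc k)) → c ≢ p → c ≢ q →
                   ∃₂ λ p′ q′ → punchIn c p′ ≡ p × punchIn c q′ ≡ q × Adjacent p′ q′
Adjacent-punchIn first zero c≢p _ = ⊥-elim (c≢p refl)
Adjacent-punchIn first (suc zero) _ c≢q = ⊥-elim (c≢q refl)
Adjacent-punchIn {suc (suc k)} first (suc (suc c)) _ _ = zero , suc zero , refl , refl , first
Adjacent-punchIn (next {p = p} {q} a) zero _ _ = p , q , refl , refl , a
Adjacent-punchIn {suc k} (next a) (suc c) c≢p c≢q
  with p′ , q′ , p≡ , q≡ , a′ ← Adjacent-punchIn a c (c≢p ∘ cong suc) (c≢q ∘ cong suc)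
  = suc p′ , suc q′ , cong suc p≡ , cong suc q≡ , next a′

punchIn-Adjacent : ∀ {k} {p q : Fin (suc k)} → Adjacent p q → ∀ b →
                   punchIn p b ≡ punchIn q b ⊎ (punchIn p b ≡ q × punchIn q b ≡ p)
punchIn-Adjacent first zero = inj₂ (refl , refl)
punchIn-Adjacent first (suc b) = inj₁ refl
punchIn-Adjacent (next a) zero = inj₁ refl
punchIn-Adjacent {suc k} (next a) (suc b) with punchIn-Adjacent a b
... | inj₁ eq         = inj₁ (cong suc eq)
... | inj₂ (eq , eq′) = inj₂ (cong suc eq , cong suc eq′)

altΣ-Adjacent : ∀ {n} {p q : Fin n} (f : Fin n → ℤω) → Adjacent p q →
                (∀ c → c ≢ p → c ≢ q → f c ≡ 0ω) → f p ≡ f q → altΣ f ≡ 0ω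
altΣ-Adjacent f first f≡0 fp≡fq = begin
  f zero +ω -ω (f (suc zero) +ω -ω altΣ (λ c → f (suc (suc c))))
    ≡⟨ cong (λ z → f zero +ω -ω (z +ω -ω altΣ (λ c → f (suc (suc c))))) fp≡fq ⟨
  f zero +ω -ω (f zero +ω -ω altΣ (λ c → f (suc (suc c))))
    ≡⟨ cong (λ z → f zero +ω -ω (f zero +ω -ω z)) (altΣ-zero _ (λ c → f≡0 (suc (suc c)) (λ ()) (λ ()))) ⟩
  f zero +ω -ω (f zero +ω -ω 0ω)
    ≡⟨ cancel (f zero) ⟩
  0ω ∎
  where
  open ≡-Reasoning
  cancel : ∀ a → a +ω -ω (a +ω -ω 0ω) ≡ 0ω
  cancel = solve-∀ ℤω-ring
altΣ-Adjacent f (next a) f≡0 fp≡fq =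
  cong₂ (λ u v → u +ω (-ω v)) (f≡0 zero (λ ()) (λ ()))
        (altΣ-Adjacent (f ∘ suc) a (λ c c≢p c≢q → f≡0 (suc c) (c≢p ∘ suc-injective) (c≢q ∘ suc-injective)) fp≡fq)

det-Adjacent-equal : ∀ {k} (A : Matrix k k) {p q : Fin k} → Adjacent p q → (∀ x → A x p ≡ A x q) → det A ≡ 0ω
det-Adjacent-equal {suc k} A {p} {q} a Ap≗Aq =
  altΣ-Adjacent _ a other-terms-vanish (cong₂ _*ω_ (Ap≗Aq zero) (det-cong same-minor))
  where
  other-terms-vanish : ∀ c → c ≢ p → c ≢ q → A zero c *ω det (minor c A) ≡ 0ω
  other-terms-vanish c c≢p c≢q with p′ , q′ , p≡ , q≡ , a′ ← Adjacent-punchIn a c c≢p c≢q =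
    trans (cong (A zero c *ω_) (det-Adjacent-equal (minor c A) a′ (λ x →
            trans (cong (A (suc x)) p≡) (trans (Ap≗Aq (suc x)) (cong (A (suc x)) (sym q≡))))))
          (*ω-zeroʳ (A zero c))
  same-minor : ∀ x b → minor p A x b ≡ minor q A x b
  same-minor x b with punchIn-Adjacent a b
  ... | inj₁ eq         = cong (A (suc x)) eq
  ... | inj₂ (eq , eq′) = trans (cong (A (suc x)) eq) (trans (sym (Ap≗Aq (suc x))) (cong (A (suc x)) (sym eq′)))

setColumn : ∀ {r k} → Fin k → (Fin r → ℤω) → Matrix r k → Matrix r k
setColumn p v A x = updateAt (A x) p (λ _ → v x)

setColumn-≡ : ∀ {r k} (p : Fin k) v (A : Matrix r k) x → setColumn p v A x p ≡ v x
setColumn-≡ p v A x = updateAt-updates p (A x)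

setColumn-≢ : ∀ {r k} (p : Fin k) v (A : Matrix r k) x {b} → b ≢ p → setColumn p v A x b ≡ A x b
setColumn-≢ p v A x {b} b≢p = updateAt-minimal b p (A x) b≢p

transpose-≡ˡ : ∀ {k} (i j : Fin k) → transpose i j i ≡ j
transpose-≡ˡ i j rewrite dec-true (i ≟ i) refl = refl

transpose-≡ʳ : ∀ {k} {i j : Fin k} → i ≢ j → transpose i j j ≡ i
transpose-≡ʳ {i = i} {j} i≢j rewrite dec-false (j ≟ i) (i≢j ∘ sym) | dec-true (j ≟ j) refl = refl

transpose-≢ : ∀ {k} {i j b : Fin k} → b ≢ i → b ≢ j → transpose i j b ≡ b
transpose-≢ {i = i} {j} {b} b≢i b≢j rewrite dec-false (b ≟ i) b≢i | dec-false (b ≟ j) b≢j = refl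

det-add-Adjacent : ∀ {k} (A : Matrix k k) {p q : Fin k} → Adjacent p q →
                   ∀ w → (∀ x → w x ≡ A x q +ω A x p) → det (setColumn q w A) ≡ det A
det-add-Adjacent A {p} {q} a w w≡ = begin
  det (setColumn q w A)                          ≡⟨ det-additive A Ap (setColumn q w A) q off-q off-q′ at-q ⟩
  det A +ω det Ap                                ≡⟨ cong (det A +ω_) (det-Adjacent-equal Ap a Ap≗Aq) ⟩
  det A +ω 0ω                                    ≡⟨ +ω-identityʳ (det A) ⟩
  det A                                          ∎
  where
  open ≡-Reasoning
  Ap = setColumn q (λ x → A x p) A
  off-q : ∀ x b → b ≢ q → A x b ≡ setColumn q w A x b
  off-q x b b≢q = sym (setColumn-≢ q w A x b≢q)
  off-q′ : ∀ x b → b ≢ q → Ap x b ≡ setColumn q w A x b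
  off-q′ x b b≢q = trans (setColumn-≢ q (λ x → A x p) A x b≢q) (off-q x b b≢q)
  at-q : ∀ x → setColumn q w A x q ≡ A x q +ω Ap x q
  at-q x = trans (setColumn-≡ q w A x) (trans (w≡ x) (cong (A x q +ω_) (sym (setColumn-≡ q (λ x → A x p) A x))))
  Ap≗Aq : ∀ x → Ap x p ≡ Ap x q
  Ap≗Aq x = trans (setColumn-≢ q (λ x → A x p) A x (Adjacent⇒≢ a)) (sym (setColumn-≡ q (λ x → A x p) A x))

-- Put w = A[p] + A[q] into both columns p and q: the result has determinant 0, and expanding it
-- by additivity in column p, then adding column p to column q, gives det A + det (swapped A).
det-swap-Adjacent : ∀ {k} (A : Matrix k k) {p q : Fin k} → Adjacent p q →
                    det (λ x b → A x (transpose p q b)) ≡ -ω det A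
det-swap-Adjacent A {p} {q} a = sum≡0⇒≡-ω (det A) (det A′) (begin
    det A +ω det A′    ≡⟨ cong₂ _+ω_ (det-add-Adjacent A a w (λ x → +ω-comm (A x p) (A x q)))
                                     (det-add-Adjacent A′ a w (λ x → cong₂ _+ω_ (sym (A′q x)) (sym (A′p x)))) ⟨
    det Aw +ω det A′w  ≡⟨ det-additive Aw A′w C p (λ x b b≢p → sym (setColumn-≢ p w Aw x b≢p)) A′w≗C Cp ⟨
    det C              ≡⟨ det-Adjacent-equal C a (λ x → trans (Cp′ x) (sym (Cq x))) ⟩
    0ω                 ∎)
  where
  open ≡-Reasoning
  p≢q = Adjacent⇒≢ a
  A′ : Matrix _ _
  A′ x b = A x (transpose p q b)
  A′p : ∀ x → A′ x p ≡ A x q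
  A′p x = cong (A x) (transpose-≡ˡ p q)
  A′q : ∀ x → A′ x q ≡ A x p
  A′q x = cong (A x) (transpose-≡ʳ p≢q)
  w : Fin _ → ℤω
  w x = A x p +ω A x q
  Aw A′w C : Matrix _ _
  Aw  = setColumn q w A
  A′w = setColumn q w A′
  C   = setColumn p w Aw
  Cp′ : ∀ x → C x p ≡ w x
  Cp′ x = setColumn-≡ p w Aw x
  Cq : ∀ x → C x q ≡ w x
  Cq x = trans (setColumn-≢ p w Aw x (p≢q ∘ sym)) (setColumn-≡ q w A x)
  Cp : ∀ x → C x p ≡ Aw x p +ω A′w x p
  Cp x = trans (Cp′ x) (sym (cong₂ _+ω_ (setColumn-≢ q w A x p≢q)
                                        (trans (setColumn-≢ q w A′ x p≢q) (A′p x))))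
  A′w≗C : ∀ x b → b ≢ p → A′w x b ≡ C x b
  A′w≗C x b b≢p with b ≟ q
  ... | yes refl = trans (setColumn-≡ b w A′ x) (sym (Cq x))
  ... | no b≢q = begin
    A′w x b ≡⟨ setColumn-≢ q w A′ x b≢q ⟩
    A′ x b  ≡⟨ cong (A x) (transpose-≢ b≢p b≢q) ⟩
    A x b   ≡⟨ setColumn-≢ q w A x b≢q ⟨
    Aw x b  ≡⟨ setColumn-≢ p w Aw x b≢p ⟨
    C x b   ∎
  sum≡0⇒≡-ω : ∀ a b → a +ω b ≡ 0ω → b ≡ -ω a
  sum≡0⇒≡-ω a b a+b≡0 = trans (regroup a b) (trans (cong (-ω a +ω_) a+b≡0) (+ω-identityʳ (-ω a)))
    where
    regroup : ∀ a b → b ≡ -ω a +ω (a +ω b)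
    regroup = solve-∀ ℤω-ring

-- Move column q next to p by adjacent swaps, each of which only changes the sign.
private
  det-equal-columns-at : ∀ d {k} (A : Matrix k k) {p q : Fin k} → toℕ q ≡ suc (d ℕ.+ toℕ p) →
                         (∀ x → A x p ≡ A x q) → det A ≡ 0ω
  det-equal-columns-at zero A {p} {suc q} q≡ Ap≗Aq =
    det-Adjacent-equal A (subst (λ r → Adjacent r (suc q)) r≡p (inject₁-Adjacent q)) Ap≗Aq
    where
    r≡p : inject₁ q ≡ p
    r≡p = toℕ-injective (trans (toℕ-inject₁ q) (ℕₚ.suc-injective q≡))
  det-equal-columns-at (suc d) A {p} {suc q} q≡ Ap≗Aq =
    -ω≡0ω⇒≡0ω (det A)
      (trans (sym (det-swap-Adjacent A (inject₁-Adjacent q))) (det-equal-columns-at d A′ r≡ A′p≗A′r))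
    where
    r = inject₁ q
    r≡ : toℕ r ≡ suc (d ℕ.+ toℕ p)
    r≡ = trans (toℕ-inject₁ q) (ℕₚ.suc-injective q≡)
    p≢r : p ≢ r
    p≢r p≡r = ℕₚ.m≢1+n+m (toℕ p) (trans (cong toℕ p≡r) r≡)
    p≢q : p ≢ suc q
    p≢q p≡q = ℕₚ.m≢1+n+m (toℕ p) (trans (cong toℕ p≡q) q≡)
    A′ : Matrix _ _
    A′ x b = A x (transpose r (suc q) b)
    A′p≗A′r : ∀ x → A′ x p ≡ A′ x r
    A′p≗A′r x = trans (cong (A x) (transpose-≢ p≢r p≢q))
      (trans (Ap≗Aq x) (sym (cong (A x) (transpose-≡ˡ r (suc q)))))

det-equal-columns : ∀ {k} (A : Matrix k k) {p q : Fin k} → p ≢ q → (∀ x → A x p ≡ A x q) → det A ≡ 0ω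
det-equal-columns A {p} {q} p≢q Ap≗Aq with ℕₚ.<-cmp (toℕ p) (toℕ q)
... | tri< p<q _ _ with d , eq ← ℕₚ.m≤n⇒∃[o]m+o≡n p<q =
  det-equal-columns-at d A (trans (sym eq) (cong suc (ℕₚ.+-comm (toℕ p) d))) Ap≗Aq
... | tri≈ _ p≡q _ = ⊥-elim (p≢q (toℕ-injective p≡q))
... | tri> _ _ q<p with d , eq ← ℕₚ.m≤n⇒∃[o]m+o≡n q<p =
  det-equal-columns-at d A (trans (sym eq) (cong suc (ℕₚ.+-comm (toℕ q) d))) (sym ∘ Ap≗Aq)

det-row₀-single : ∀ {k} (A : Matrix (suc k) (suc k)) (p : Fin (suc k)) →
  (∀ c → c ≢ p → A zero c *ω det (minor c A) ≡ 0ω) →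
  det A ≡ A zero p *ω det (minor p A) ⊎ det A ≡ -ω (A zero p *ω det (minor p A))
det-row₀-single A p = altΣ-single (λ c → A zero c *ω det (minor c A)) p

-- Linear dependence

combo-linear : ∀ {r n} (A : Matrix r n) (s t : ℤω) (u v : Fin n → ℤω) x →
               combo A (λ e → s *ω u e +ω t *ω v e) x ≡ s *ω combo A u x +ω t *ω combo A v x
combo-linear A s t u v x = begin
  Σ[ (λ e → (s *ω u e +ω t *ω v e) *ω A x e) ]
    ≡⟨ Σ-cong (λ e → distrib s t (u e) (v e) (A x e)) ⟩
  Σ[ (λ e → s *ω (u e *ω A x e) +ω t *ω (v e *ω A x e)) ]
    ≡⟨ Σ-distrib-+ (λ e → s *ω (u e *ω A x e)) (λ e → t *ω (v e *ω A x e)) ⟩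
  Σ[ (λ e → s *ω (u e *ω A x e)) ] +ω Σ[ (λ e → t *ω (v e *ω A x e)) ]
    ≡⟨ cong₂ _+ω_ (*ω-distribˡ-Σ s (λ e → u e *ω A x e)) (*ω-distribˡ-Σ t (λ e → v e *ω A x e)) ⟨
  s *ω combo A u x +ω t *ω combo A v x ∎
  where
  open ≡-Reasoning
  distrib : ∀ s t u v a → (s *ω u +ω t *ω v) *ω a ≡ s *ω (u *ω a) +ω t *ω (v *ω a)
  distrib = solve-∀ ℤω-ring

ColumnsDependent : ∀ {r n} → Matrix r n → Set
ColumnsDependent A = ∃ λ l → (∀ x → combo A l x ≡ 0ω) × ∃ λ t → l t ≢ 0ω

zero-or-nonzero : ∀ {n} (f : Fin n → ℤω) → (∀ t → f t ≡ 0ω) ⊎ ∃ λ t → f t ≢ 0ω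
zero-or-nonzero {n} f with all? (λ t → f t ≟ω 0ω)
... | yes f≡0 = inj₁ f≡0
... | no f≢0  = inj₂ (¬∀⟶∃¬ n _ (λ t → f t ≟ω 0ω) f≢0)

dependent-zero-row : ∀ {k n} (A : Matrix (suc k) n) → (∀ t → A zero t ≡ 0ω) →
                     ColumnsDependent (A ∘ suc) → ColumnsDependent A
dependent-zero-row A A₀≡0 (l , Al≡0 , nonzero) = l , Al≡0′ , nonzero
  where
  Al≡0′ : ∀ x → combo A l x ≡ 0ω
  Al≡0′ zero    = Σ-zero (λ t → l t *ω A zero t) (λ t → trans (cong (l t *ω_) (A₀≡0 t)) (*ω-zeroʳ (l t)))
  Al≡0′ (suc x) = Al≡0 x

-- One step of Gaussian elimination with pivot A₀ₚ.
eliminate : ∀ {k m} → Matrix (suc k) (suc m) → Fin (suc m) → Matrix k m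
eliminate A p x t = A zero p *ω A (suc x) (punchIn p t) +ω -ω (A zero (punchIn p t) *ω A (suc x) p)

-- A dependence μ of the eliminated matrix lifts to l = (A₀ₚ μ with -Σₜ μₜ A₀,ₜ inserted at p).
eliminate-dependent : ∀ {k m} (A : Matrix (suc k) (suc m)) (p : Fin (suc m)) → A zero p ≢ 0ω →
                      ColumnsDependent (eliminate A p) → ColumnsDependent A
eliminate-dependent A p a≢0 (μ , Eμ≡0 , s , μs≢0) = l , Al≡0 , punchIn p s , ls≢0
  where
  a = A zero p
  S = Σ[ (λ t → μ t *ω A zero (punchIn p t)) ]
  l = insertAt (λ t → a *ω μ t) p (-ω S)
  Al≡Eμ : ∀ x → combo A l x ≡ Σ[ (λ t → μ t *ω (a *ω A x (punchIn p t) +ω -ω (A zero (punchIn p t) *ω A x p))) ]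
  Al≡Eμ x = begin
    combo A l x
      ≡⟨ Σ-remove (λ t → l t *ω A x t) p ⟩
    l p *ω A x p +ω Σ[ (λ t → l (punchIn p t) *ω A x (punchIn p t)) ]
      ≡⟨ cong₂ _+ω_ (cong (_*ω A x p) (insertAt-lookup _ p (-ω S)))
                    (Σ-cong (λ t → cong (_*ω A x (punchIn p t)) (insertAt-punchIn _ p (-ω S) t))) ⟩
    (-ω S) *ω A x p +ω Σ[ (λ t → (a *ω μ t) *ω A x (punchIn p t)) ]
      ≡⟨ cong (_+ω Σ[ (λ t → (a *ω μ t) *ω A x (punchIn p t)) ]) (neg-swap S (A x p)) ⟩
    (-ω A x p) *ω S +ω Σ[ (λ t → (a *ω μ t) *ω A x (punchIn p t)) ]
      ≡⟨ cong (_+ω Σ[ (λ t → (a *ω μ t) *ω A x (punchIn p t)) ])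
          (*ω-distribˡ-Σ (-ω A x p) (λ t → μ t *ω A zero (punchIn p t))) ⟩
    Σ[ (λ t → (-ω A x p) *ω (μ t *ω A zero (punchIn p t))) ] +ω Σ[ (λ t → (a *ω μ t) *ω A x (punchIn p t)) ]
      ≡⟨ Σ-distrib-+ (λ t → (-ω A x p) *ω (μ t *ω A zero (punchIn p t))) (λ t → (a *ω μ t) *ω A x (punchIn p t)) ⟨
    Σ[ (λ t → (-ω A x p) *ω (μ t *ω A zero (punchIn p t)) +ω (a *ω μ t) *ω A x (punchIn p t)) ]
      ≡⟨ Σ-cong (λ t → regroup (A x p) (μ t) (A zero (punchIn p t)) a (A x (punchIn p t))) ⟩
    Σ[ (λ t → μ t *ω (a *ω A x (punchIn p t) +ω -ω (A zero (punchIn p t) *ω A x p))) ] ∎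
    where
    open ≡-Reasoning
    neg-swap : ∀ s b → (-ω s) *ω b ≡ (-ω b) *ω s
    neg-swap = solve-∀ ℤω-ring
    regroup : ∀ b m c a d → (-ω b) *ω (m *ω c) +ω (a *ω m) *ω d ≡ m *ω (a *ω d +ω -ω (c *ω b))
    regroup = solve-∀ ℤω-ring
  Al≡0 : ∀ x → combo A l x ≡ 0ω
  Al≡0 zero    = trans (Al≡Eμ zero)
    (Σ-zero (λ t → μ t *ω (a *ω A zero (punchIn p t) +ω -ω (A zero (punchIn p t) *ω A zero p)))
            (λ t → cancel (μ t) a (A zero (punchIn p t))))
    where
    cancel : ∀ m a b → m *ω (a *ω b +ω -ω (b *ω a)) ≡ 0ω
    cancel = solve-∀ ℤω-ring
  Al≡0 (suc x) = trans (Al≡Eμ (suc x)) (Eμ≡0 x)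
  ls≢0 : l (punchIn p s) ≢ 0ω
  ls≢0 ls≡0 = μs≢0 (xy≡0∧x≢0⇒y≡0 (trans (sym (insertAt-punchIn (λ t → a *ω μ t) p (-ω S) s)) ls≡0) a≢0)

dependent-if-wide : ∀ k {m} → k ℕ.< m → (A : Matrix k m) → ColumnsDependent A
dependent-if-wide zero    {suc m} _ A = (λ _ → 1ω) , (λ ()) , zero , (λ ())
dependent-if-wide (suc k) {suc m} (ℕ.s≤s k<m) A with zero-or-nonzero (A zero)
... | inj₁ A₀≡0 = dependent-zero-row A A₀≡0 (dependent-if-wide k (ℕₚ.m≤n⇒m≤1+n k<m) (A ∘ suc))
... | inj₂ (p , a≢0) = eliminate-dependent A p a≢0 (dependent-if-wide k k<m (eliminate A p))

Σ-combo-transpose : ∀ {r m} (A : Matrix r m) (y : Fin r → ℤω) (l : Fin m → ℤω) →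
  Σ[ (λ x → y x *ω combo A l x) ] ≡ Σ[ (λ t → l t *ω combo (λ t x → A x t) y t) ]
Σ-combo-transpose A y l = begin
  Σ[ (λ x → y x *ω combo A l x) ]                    ≡⟨ Σ-cong (λ x → *ω-distribˡ-Σ (y x) (λ t → l t *ω A x t)) ⟩
  Σ[ (λ x → Σ[ (λ t → y x *ω (l t *ω A x t)) ]) ]    ≡⟨ Σ-comm (λ x t → y x *ω (l t *ω A x t)) ⟩
  Σ[ (λ t → Σ[ (λ x → y x *ω (l t *ω A x t)) ]) ]    ≡⟨ Σ-cong (λ t → Σ-cong (λ x → swap (y x) (l t) (A x t))) ⟩
  Σ[ (λ t → Σ[ (λ x → l t *ω (y x *ω A x t)) ]) ]    ≡⟨ Σ-cong (λ t → *ω-distribˡ-Σ (l t) (λ x → y x *ω A x t)) ⟨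
  Σ[ (λ t → l t *ω combo (λ t x → A x t) y t) ]      ∎
  where
  open ≡-Reasoning
  swap : ∀ a b c → a *ω (b *ω c) ≡ b *ω (a *ω c)
  swap = solve-∀ ℤω-ring

det-zero-column : ∀ {k} (A : Matrix k k) (p : Fin k) → (∀ x → A x p ≡ 0ω) → det A ≡ 0ω
det-zero-column A p Ap≡0 =
  trans (det-linear A A A p 0ω 0ω (λ _ _ _ → refl) (λ _ _ _ → refl) (λ x → trans (Ap≡0 x) (sym (0*+0* (A x p)))))
        (0*+0* (det A))
  where
  0*+0* : ∀ a → 0ω *ω a +ω 0ω *ω a ≡ 0ω
  0*+0* = solve-∀ ℤω-ring

det-setColumn-Σ : ∀ {k m} (A : Matrix k k) (p : Fin k) (c : Fin m → ℤω) (u : Fin m → Fin k → ℤω) →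
  det (setColumn p (λ x → Σ[ (λ t → c t *ω u t x) ]) A) ≡ Σ[ (λ t → c t *ω det (setColumn p (u t) A)) ]
det-setColumn-Σ {m = zero} A p c u = det-zero-column _ p (setColumn-≡ p (λ _ → 0ω) A)
det-setColumn-Σ {m = suc m} A p c u =
  trans (det-linear (setColumn p (u zero) A) (setColumn p R A) (setColumn p V A) p (c zero) 1ω
           (λ x b b≢p → trans (setColumn-≢ p (u zero) A x b≢p) (sym (setColumn-≢ p V A x b≢p)))
           (λ x b b≢p → trans (setColumn-≢ p R A x b≢p) (sym (setColumn-≢ p V A x b≢p)))
           (λ x → trans (setColumn-≡ p V A x)
                        (sym (cong₂ _+ω_ (cong (c zero *ω_) (setColumn-≡ p (u zero) A x))
                                         (trans (*ω-identityˡ _) (setColumn-≡ p R A x))))))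
        (cong (c zero *ω det (setColumn p (u zero) A) +ω_)
              (trans (*ω-identityˡ _) (det-setColumn-Σ A p (c ∘ suc) (u ∘ suc))))
  where
  V R : Fin _ → ℤω
  V x = Σ[ (λ t → c t *ω u t x) ]
  R x = Σ[ (λ t → c (suc t) *ω u (suc t) x) ]

cramer : ∀ {k} (A : Matrix k k) (p : Fin k) (c : Fin k → ℤω) → det (setColumn p (combo A c) A) ≡ c p *ω det A
cramer A p c = begin
  det (setColumn p (combo A c) A)                           ≡⟨ det-setColumn-Σ A p c (λ t x → A x t) ⟩
  Σ[ (λ t → c t *ω det (setColumn p (λ x → A x t) A)) ]     ≡⟨ Σ-single _ p other-columns ⟩
  c p *ω det (setColumn p (λ x → A x p) A)                  ≡⟨ cong (c p *ω_) (det-cong setColumn-self) ⟩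
  c p *ω det A                                              ∎
  where
  open ≡-Reasoning
  other-columns : ∀ t → t ≢ p → c t *ω det (setColumn p (λ x → A x t) A) ≡ 0ω
  other-columns t t≢p = trans (cong (c t *ω_) (det-equal-columns _ (t≢p ∘ sym)
      (λ x → trans (setColumn-≡ p (λ x → A x t) A x) (sym (setColumn-≢ p (λ x → A x t) A x t≢p)))))
    (*ω-zeroʳ (c t))
  setColumn-self : ∀ x b → setColumn p (λ x → A x p) A x b ≡ A x b
  setColumn-self x b with b ≟ p
  ... | yes refl = setColumn-≡ b (λ x → A x b) A x
  ... | no b≢p   = setColumn-≢ p (λ x → A x p) A x b≢p

-- By Cramer, replacing column p by A l = (s, 0, …, 0)ᵀ gives determinant l p · det A = 0,
-- while Laplace expansion along row 0 gives ± s · det (minor p A).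
private
  singular-minor : ∀ {k} (A : Matrix (suc k) (suc k)) (l : Fin (suc k) → ℤω) (p : Fin (suc k)) →
    det A ≡ 0ω → (∀ x → combo A l (suc x) ≡ 0ω) → combo A l zero ≢ 0ω → det (minor p A) ≡ 0ω
  singular-minor A l p detA≡0 Al≡0 s≢0 = xy≡0∧x≢0⇒y≡0 s*minor≡0 s≢0
    where
    s = combo A l zero
    B = setColumn p (combo A l) A
    detB≡0 : det B ≡ 0ω
    detB≡0 = trans (cramer A p l) (trans (cong (l p *ω_) detA≡0) (*ω-zeroʳ (l p)))
    other-terms : ∀ c → c ≢ p → B zero c *ω det (minor c B) ≡ 0ω
    other-terms c c≢p = trans (cong (B zero c *ω_) (det-zero-column (minor c B) (punchOut c≢p)
        (λ x → trans (cong (B (suc x)) (punchIn-punchOut c≢p))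
          (trans (setColumn-≡ p (combo A l) A (suc x)) (Al≡0 x)))))
      (*ω-zeroʳ (B zero c))
    term-p : B zero p *ω det (minor p B) ≡ s *ω det (minor p A)
    term-p = cong₂ _*ω_ (setColumn-≡ p (combo A l) A zero)
                        (det-cong (λ x b → setColumn-≢ p (combo A l) A (suc x) (punchInᵢ≢i p b)))
    s*minor≡0 : s *ω det (minor p A) ≡ 0ω
    s*minor≡0 = [ (λ detB≡  → trans (sym term-p) (trans (sym detB≡) detB≡0))
                , (λ detB≡- → trans (sym term-p)
              (-ω≡0ω⇒≡0ω (B zero p *ω det (minor p B)) (trans (sym detB≡-) detB≡0))) ]′
                (det-row₀-single B p other-terms)

  -- The dependence is v itself or (A v)₀ u - (A u)₀ v.
  combine-dependent : ∀ {k n} (A : Matrix (suc k) n) (u v : Fin n → ℤω) {p : Fin n} →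
    (∀ x → combo A u (suc x) ≡ 0ω) → (∀ x → combo A v (suc x) ≡ 0ω) →
    u p ≢ 0ω → v p ≡ 0ω → (∃ λ t → v t ≢ 0ω) → ColumnsDependent A
  combine-dependent A u v {p} Au≡0 Av≡0 up≢0 vp≡0 v≢0 = by-cases (combo A v zero ≟ω 0ω)
    where
    by-cases : Dec (combo A v zero ≡ 0ω) → ColumnsDependent A
    by-cases (yes Av₀≡0) = v , (λ { zero → Av₀≡0 ; (suc x) → Av≡0 x }) , v≢0
    by-cases (no Av₀≢0)  = w , Aw≡0 , p , wp≢0
      where
      w = λ t → combo A v zero *ω u t +ω (-ω combo A u zero) *ω v t
      cancel : ∀ a b → b *ω a +ω (-ω a) *ω b ≡ 0ω
      cancel = solve-∀ ℤω-ring
      vanish : ∀ x → combo A v zero *ω combo A u x +ω (-ω combo A u zero) *ω combo A v x ≡ 0ω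
      vanish zero    = cancel (combo A u zero) (combo A v zero)
      vanish (suc x) = trans (cong₂ (λ a b → combo A v zero *ω a +ω (-ω combo A u zero) *ω b) (Au≡0 x) (Av≡0 x))
                             (cong₂ _+ω_ (*ω-zeroʳ (combo A v zero)) (*ω-zeroʳ (-ω combo A u zero)))
      Aw≡0 : ∀ x → combo A w x ≡ 0ω
      Aw≡0 x = trans (combo-linear A (combo A v zero) (-ω combo A u zero) u v x) (vanish x)
      wp≡ : w p ≡ combo A v zero *ω u p
      wp≡ = begin
        combo A v zero *ω u p +ω (-ω combo A u zero) *ω v p
          ≡⟨ cong (λ z → combo A v zero *ω u p +ω (-ω combo A u zero) *ω z) vp≡0 ⟩
        combo A v zero *ω u p +ω (-ω combo A u zero) *ω 0ω
          ≡⟨ cong (combo A v zero *ω u p +ω_) (*ω-zeroʳ (-ω combo A u zero)) ⟩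
        combo A v zero *ω u p +ω 0ω
          ≡⟨ +ω-identityʳ (combo A v zero *ω u p) ⟩
        combo A v zero *ω u p ∎
        where open ≡-Reasoning
      wp≢0 : w p ≢ 0ω
      wp≢0 wp≡0 = up≢0 (xy≡0∧x≢0⇒y≡0 (trans (sym wp≡) wp≡0) Av₀≢0)

  insertAt-minor-dependence : ∀ {k} (A : Matrix (suc k) (suc k)) (p : Fin (suc k)) (μ : Fin k → ℤω) →
    (∀ x → combo (minor p A) μ x ≡ 0ω) → ∀ x → combo A (insertAt μ p 0ω) (suc x) ≡ 0ω
  insertAt-minor-dependence A p μ minor·μ≡0 x = begin
    combo A ν (suc x)
      ≡⟨ Σ-remove (λ t → ν t *ω A (suc x) t) p ⟩
    ν p *ω A (suc x) p +ω Σ[ (λ t → ν (punchIn p t) *ω A (suc x) (punchIn p t)) ]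
      ≡⟨ cong₂ (λ a b → a *ω A (suc x) p +ω b) (insertAt-lookup μ p 0ω)
               (Σ-cong (λ t → cong (_*ω A (suc x) (punchIn p t)) (insertAt-punchIn μ p 0ω t))) ⟩
    0ω *ω A (suc x) p +ω combo (minor p A) μ x
      ≡⟨ cong₂ _+ω_ (*ω-zeroˡ (A (suc x) p)) (minor·μ≡0 x) ⟩
    0ω ∎
    where
    open ≡-Reasoning
    ν = insertAt μ p 0ω

-- Steinitz gives l killing rows 1…k; if it does not kill row 0, the minor at a support position
-- p of l is singular, and a dependence of that minor, extended by 0 at p, is combined with l.
det≡0⇒dependent : ∀ {k} (A : Matrix k k) → det A ≡ 0ω → ColumnsDependent A
det≡0⇒dependent {zero} A ()
det≡0⇒dependent {suc k} A detA≡0 = extend (dependent-if-wide k (ℕₚ.n<1+n k) (A ∘ suc))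
  where
  extend : ColumnsDependent (A ∘ suc) → ColumnsDependent A
  extend (l , Al≡0 , p , lp≢0) = by-cases (combo A l zero ≟ω 0ω)
    where
    by-cases : Dec (combo A l zero ≡ 0ω) → ColumnsDependent A
    by-cases (yes Al₀≡0) = l , (λ { zero → Al₀≡0 ; (suc x) → Al≡0 x }) , p , lp≢0
    by-cases (no Al₀≢0) = from-minor (det≡0⇒dependent (minor p A) (singular-minor A l p detA≡0 Al≡0 Al₀≢0))
      where
      from-minor : ColumnsDependent (minor p A) → ColumnsDependent A
      from-minor (μ , minor·μ≡0 , q , μq≢0) =
        combine-dependent A l (insertAt μ p 0ω) Al≡0 (insertAt-minor-dependence A p μ minor·μ≡0) lp≢0
          (insertAt-lookup μ p 0ω) (punchIn p q , λ νq≡0 → μq≢0 (trans (sym (insertAt-punchIn μ p 0ω q)) νq≡0))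

-- Sorting columns

module _ where
  open import Data.Nat using (_+_; _*_; _≤_; _<_)
  open import Algebra.Properties.Semiring.Sum ℕₚ.+-*-semiring
    using () renaming (sum to sumℕ; sum-cong-≗ to sumℕ-cong-≗)

  columns : ∀ {r n k} → Matrix r n → (Fin k → Fin n) → Matrix r k
  columns A κ x b = A x (κ b)

  Ascending : ∀ {k n} → (Fin (suc k) → Fin n) → Set
  Ascending {k} κ = ∀ (t : Fin k) → toℕ (κ (inject₁ t)) < toℕ (κ (suc t))

  Ascending⇒StrictlyIncreasing : ∀ {k n} (κ : Fin (suc k) → Fin n) → Ascending κ → StrictlyIncreasing κ
  Ascending⇒StrictlyIncreasing {suc k} κ asc zero (suc b) _ = ℕₚ.<-≤-trans (asc zero) (κ1≤ b)
    where
    κ1≤ : ∀ b → toℕ (κ (suc zero)) ≤ toℕ (κ (suc b))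
    κ1≤ zero    = ℕₚ.≤-refl
    κ1≤ (suc b) = ℕₚ.<⇒≤ (Ascending⇒StrictlyIncreasing (κ ∘ suc) (asc ∘ suc) zero (suc b) (ℕ.s≤s ℕ.z≤n))
  Ascending⇒StrictlyIncreasing {suc k} κ asc (suc a) (suc b) (ℕ.s≤s a<b) =
    Ascending⇒StrictlyIncreasing (κ ∘ suc) (asc ∘ suc) a b a<b

  private
    weight : ∀ {k n} → (Fin k → Fin n) → ℕ
    weight κ = sumℕ (λ b → toℕ b * toℕ (κ b))

    sumℕ-≤ : ∀ {k} (f : Fin k → ℕ) C → (∀ b → f b ≤ C) → sumℕ f ≤ k * C
    sumℕ-≤ {zero}  f C f≤C = ℕ.z≤n
    sumℕ-≤ {suc k} f C f≤C = ℕₚ.+-mono-≤ (f≤C zero) (sumℕ-≤ (f ∘ suc) C (f≤C ∘ suc))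

    weight-≤ : ∀ {k n} (κ : Fin k → Fin n) → weight κ ≤ k * (k * n)
    weight-≤ κ = sumℕ-≤ _ _ (λ b → ℕₚ.*-mono-≤ (ℕₚ.<⇒≤ (toℕ<n b)) (ℕₚ.<⇒≤ (toℕ<n (κ b))))

    sumℕ-<-Adjacent : ∀ {k} {p q : Fin k} (f g : Fin k → ℕ) → Adjacent p q →
                     (∀ b → b ≢ p → b ≢ q → f b ≡ g b) → f p + f q < g p + g q → sumℕ f < sumℕ g
    sumℕ-<-Adjacent f g first f≡g lt = subst₂ _<_ (ℕₚ.+-assoc (f zero) (f (suc zero)) _)
      (ℕₚ.+-assoc (g zero) (g (suc zero)) _)
      (subst (λ z → f zero + f (suc zero) + sumℕ (λ b → f (suc (suc b))) < g zero + g (suc zero) + z)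
             (sumℕ-cong-≗ (λ b → f≡g (suc (suc b)) (λ ()) (λ ())))
             (ℕₚ.+-monoˡ-< (sumℕ (λ b → f (suc (suc b)))) lt))
    sumℕ-<-Adjacent f g (next a) f≡g lt = subst (λ z → f zero + sumℕ (f ∘ suc) < z + sumℕ (g ∘ suc))
      (f≡g zero (λ ()) (λ ()))
      (ℕₚ.+-monoʳ-< (f zero) (sumℕ-<-Adjacent (f ∘ suc) (g ∘ suc) a
        (λ b b≢p b≢q → f≡g (suc b) (b≢p ∘ suc-injective) (b≢q ∘ suc-injective)) lt))

    -- Swapping an adjacent descent a > b at positions P, P + 1 raises the weight by a - b.
    weight-<-swap : ∀ {k n} (κ : Fin k → Fin n) {p q : Fin k} → Adjacent p q → toℕ (κ q) < toℕ (κ p) →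
                    weight κ < weight (κ ∘ transpose q p)
    weight-<-swap κ {p} {q} a κq<κp = sumℕ-<-Adjacent _ _ a
      (λ b b≢p b≢q → cong (λ c → toℕ b * toℕ (κ c)) (sym (transpose-≢ b≢q b≢p)))
      (subst₂ (λ u v → toℕ p * toℕ (κ p) + toℕ q * toℕ (κ q) < toℕ p * toℕ (κ u) + toℕ q * toℕ (κ v))
              (sym (transpose-≡ʳ (Adjacent⇒≢ a ∘ sym))) (sym (transpose-≡ˡ q p))
              (subst (λ z → toℕ p * toℕ (κ p) + z * toℕ (κ q) < toℕ p * toℕ (κ q) + z * toℕ (κ p))
                     (sym (Adjacent⇒toℕ≡suc a))
                     (exchange-< (toℕ p) (toℕ (κ p)) (toℕ (κ q)) κq<κp)))
      where
      exchange-< : ∀ P a b → b < a → P * a + suc P * b < P * b + suc P * a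
      exchange-< P a b b<a = subst₂ _<_ (lhs P a b) (rhs P a b) (ℕₚ.+-monoʳ-< (P * a + P * b) b<a)
        where
        lhs : ∀ P a b → P * a + P * b + b ≡ P * a + suc P * b
        lhs = ℕ-Solver.solve-∀
        rhs : ∀ P a b → P * a + P * b + a ≡ P * b + suc P * a
        rhs = ℕ-Solver.solve-∀

  -- Bubble sort: swapping an adjacent descent of κ negates the determinant (and ℍ = -ℍ) while
  -- strictly raising the bounded weight Σ b · κ b.
  Inℍ-det-injective : ∀ {k n} (A : Matrix k n) → (∀ σ → StrictlyIncreasing σ → Inℍ (det (columns A σ))) →
                      ∀ κ → Injective _≡_ _≡_ κ → Inℍ (det (columns A κ))
  Inℍ-det-injective {zero} A inℍ κ _ = inℍ κ (λ ())
  Inℍ-det-injective {suc k} {n} A inℍ κ inj = sorted K κ inj (ℕₚ.m≤m+n K (weight κ))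
    where
    K = suc k * (suc k * n)
    sorted : ∀ fuel κ → Injective _≡_ _≡_ κ → K ≤ fuel + weight κ → Inℍ (det (columns A κ))
    sorted fuel κ inj K≤ with all? (λ t → toℕ (κ (inject₁ t)) ℕ.<? toℕ (κ (suc t)))
    ... | yes asc = inℍ κ (Ascending⇒StrictlyIncreasing κ asc)
    ... | no ¬asc with t , κp≮κq ← ¬∀⟶∃¬ k _ (λ t → toℕ (κ (inject₁ t)) ℕ.<? toℕ (κ (suc t))) ¬asc =
      subst Inℍ (sym det≡-det′) (Inℍ-neg (sorted′ fuel K≤))
      where
      p = inject₁ t
      q = suc t
      a = inject₁-Adjacent t
      κ′ = κ ∘ transpose q p
      κq<κp : toℕ (κ q) < toℕ (κ p)
      κq<κp = ℕₚ.≤∧≢⇒< (ℕₚ.≮⇒≥ κp≮κq) (λ eq → Adjacent⇒≢ a (sym (inj (toℕ-injective eq))))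
      inj′ : Injective _≡_ _≡_ κ′
      inj′ {x} {y} eq = trans (sym (transpose-inverse p q))
        (trans (cong (transpose p q) (inj eq)) (transpose-inverse p q))
      det≡-det′ : det (columns A κ) ≡ -ω det (columns A κ′)
      det≡-det′ = trans (det-cong unswap) (det-swap-Adjacent (columns A κ′) a)
        where
        unswap : ∀ x b → columns A κ x b ≡ columns A κ′ x (transpose p q b)
        unswap x b = cong (A x ∘ κ) (sym (transpose-inverse q p {b}))
      W< : weight κ < weight κ′
      W< = weight-<-swap κ a κq<κp
      sorted′ : ∀ fuel → K ≤ fuel + weight κ → Inℍ (det (columns A κ′))
      sorted′ zero K≤W = ⊥-elim (ℕₚ.<-irrefl refl (ℕₚ.≤-<-trans K≤W (ℕₚ.<-≤-trans W< (weight-≤ κ′))))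
      sorted′ (suc fuel) K≤ = sorted fuel κ′ inj′
        (ℕₚ.≤-trans K≤ (subst (_≤ fuel + weight κ′) (ℕₚ.+-suc fuel (weight κ)) (ℕₚ.+-monoʳ-≤ fuel W<)))

-- Subsets

StrictlyIncreasing⇒Injective : ∀ {k m} (κ : Fin k → Fin m) → StrictlyIncreasing κ → Injective _≡_ _≡_ κ
StrictlyIncreasing⇒Injective κ incr {a} {b} κa≡κb with <-cmp a b
... | tri< a<b _ _ = ⊥-elim (ℕₚ.<-irrefl (cong toℕ κa≡κb) (incr a b a<b))
... | tri≈ _ a≡b _ = a≡b
... | tri> _ _ b<a = ⊥-elim (ℕₚ.<-irrefl (cong toℕ (sym κa≡κb)) (incr b a b<a))

updateAt-injective : ∀ {k m} (κ : Fin k → Fin m) → Injective _≡_ _≡_ κ → ∀ p {j} → (∀ t → κ t ≢ j) →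
                     Injective _≡_ _≡_ (updateAt κ p (λ _ → j))
updateAt-injective κ inj p {j} j∉κ {a} {b} eq with a ≟ p | b ≟ p
... | yes refl | yes refl = refl
... | yes refl | no b≢p   = ⊥-elim (j∉κ b (trans (sym (updateAt-minimal b p κ b≢p)) (trans (sym eq) (updateAt-updates a κ))))
... | no a≢p   | yes refl = ⊥-elim (j∉κ a (trans (sym (updateAt-minimal a p κ a≢p)) (trans eq (updateAt-updates b κ))))
... | no a≢p   | no b≢p   = inj (trans (sym (updateAt-minimal a p κ a≢p)) (trans eq (updateAt-minimal b p κ b≢p)))

enum : ∀ {n} (S : Subset n) → Fin ∣ S ∣ → Fin n
enum (inside  ∷ S) zero    = zero
enum (inside  ∷ S) (suc t) = suc (enum S t)
enum (outside ∷ S) t       = suc (enum S t)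

enum-∈ : ∀ {n} (S : Subset n) t → enum S t ∈ S
enum-∈ (inside  ∷ S) zero    = here
enum-∈ (inside  ∷ S) (suc t) = there (enum-∈ S t)
enum-∈ (outside ∷ S) t       = there (enum-∈ S t)

enum-surjective : ∀ {n} (S : Subset n) {e} → e ∈ S → ∃ λ t → enum S t ≡ e
enum-surjective (inside ∷ S) here = zero , refl
enum-surjective (inside ∷ S) (there e∈S) with t , eq ← enum-surjective S e∈S = suc t , cong suc eq
enum-surjective (outside ∷ S) (there e∈S) with t , eq ← enum-surjective S e∈S = t , cong suc eq

enum-increasing : ∀ {n} (S : Subset n) → StrictlyIncreasing (enum S)
enum-increasing (inside  ∷ S) zero    (suc b) _             = ℕ.s≤s ℕ.z≤n
enum-increasing (inside  ∷ S) (suc a) (suc b) (ℕ.s≤s a<b)   = ℕ.s≤s (enum-increasing S a b a<b)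
enum-increasing (outside ∷ S) a       b       a<b           = ℕ.s≤s (enum-increasing S a b a<b)

Σ-enum : ∀ {n} (S : Subset n) (f : Fin n → ℤω) → (∀ e → e ∉ S → f e ≡ 0ω) → Σ[ f ] ≡ Σ[ f ∘ enum S ]
Σ-enum []            f f≡0 = refl
Σ-enum (inside  ∷ S) f f≡0 = cong (f zero +ω_) (Σ-enum S (f ∘ suc) (λ e e∉S → f≡0 (suc e) (e∉S ∘ drop-there)))
Σ-enum (outside ∷ S) f f≡0 = begin
  f zero +ω Σ[ f ∘ suc ]  ≡⟨ cong (_+ω Σ[ f ∘ suc ]) (f≡0 zero λ ()) ⟩
  0ω +ω Σ[ f ∘ suc ]      ≡⟨ +ω-identityˡ _ ⟩
  Σ[ f ∘ suc ]            ≡⟨ Σ-enum S (f ∘ suc) (λ e e∉S → f≡0 (suc e) (e∉S ∘ drop-there)) ⟩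
  Σ[ f ∘ suc ∘ enum S ]   ∎
  where open ≡-Reasoning

module _ {n} {S : Subset n} {f x : Fin n} where

  ∈∪⁅⁆⁻ : x ∈ S ∪ ⁅ f ⁆ → x ∈ S ⊎ x ≡ f
  ∈∪⁅⁆⁻ x∈ = Sum.map₂ (x∈⁅y⁆⇒x≡y f) (x∈p∪q⁻ S ⁅ f ⁆ x∈)

  ∈∪⁅⁆ˡ : x ∈ S → x ∈ S ∪ ⁅ f ⁆
  ∈∪⁅⁆ˡ x∈S = x∈p∪q⁺ (inj₁ x∈S)

  ∉∪⁅⁆ : x ∉ S → x ≢ f → x ∉ S ∪ ⁅ f ⁆
  ∉∪⁅⁆ x∉S x≢f x∈ = [ x∉S , x≢f ]′ (∈∪⁅⁆⁻ x∈)

∈∪⁅⁆ʳ : ∀ {n} {S : Subset n} {f} → f ∈ S ∪ ⁅ f ⁆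
∈∪⁅⁆ʳ {f = f} = x∈p∪q⁺ (inj₂ (x∈⁅x⁆ f))

x∉S-x : ∀ {n} (S : Subset n) {x} → x ∉ S Sub.- x
x∉S-x (_ ∷ S) {zero}  ()
x∉S-x (_ ∷ S) {suc x} (there x∈) = x∉S-x S x∈

module _ {n} {B : Subset n} {i j e : Fin n} where

  ∈-exch⁻ : e ∈ exch i j B → (e ∈ B × e ≢ i) ⊎ e ≡ j
  ∈-exch⁻ = Sum.map₁ (λ e∈B-i → p─q⊆p B ⁅ i ⁆ e∈B-i , λ { refl → x∉S-x B e∈B-i }) ∘ ∈∪⁅⁆⁻

  ∈-exch⁺ : e ∈ B → e ≢ i → e ∈ exch i j B
  ∈-exch⁺ e∈B e≢i = ∈∪⁅⁆ˡ (x∈p∧x≢y⇒x∈p-y e∈B e≢i)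

j∈exch : ∀ {n} {B : Subset n} {i j} → j ∈ exch i j B
j∈exch = ∈∪⁅⁆ʳ

i∉exch : ∀ {n} {B : Subset n} {i j} → i ≢ j → i ∉ exch i j B
i∉exch i≢j i∈ with ∈-exch⁻ i∈
... | inj₁ (_ , i≢i) = i≢i refl
... | inj₂ i≡j       = i≢j i≡j

exch-injective : ∀ {n} {B₁ B₂ : Subset n} {i j} → i ∈ B₁ → j ∉ B₁ → i ∈ B₂ → j ∉ B₂ →
                 exch i j B₁ ≡ exch i j B₂ → B₁ ≡ B₂
exch-injective {B₁ = B₁} {B₂} {i} {j} i∈B₁ j∉B₁ i∈B₂ j∉B₂ eq =
  ⊆-antisym (included i∈B₂ j∉B₁ eq) (included i∈B₁ j∉B₂ (sym eq))
  where
  included : ∀ {P Q} → i ∈ Q → j ∉ P → exch i j P ≡ exch i j Q → ∀ {x} → x ∈ P → x ∈ Q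
  included {P} {Q} i∈Q j∉P eq {x} x∈P with x ≟ i
  ... | yes refl = i∈Q
  ... | no x≢i with ∈-exch⁻ (subst (x ∈_) eq (∈-exch⁺ x∈P x≢i))
  ...   | inj₁ (x∈Q , _) = x∈Q
  ...   | inj₂ refl      = ⊥-elim (j∉P x∈P)

exch-exch : ∀ {n} {B : Subset n} {i j} → j ∈ B → i ∉ B → exch i j (exch j i B) ≡ B
exch-exch {B = B} {i} {j} j∈B i∉B = ⊆-antisym B″⊆B B⊆B″
  where
  B″⊆B : ∀ {x} → x ∈ exch i j (exch j i B) → x ∈ B
  B″⊆B x∈ with ∈-exch⁻ x∈
  ... | inj₂ refl = j∈B
  ... | inj₁ (x∈′ , x≢i) with ∈-exch⁻ x∈′
  ...   | inj₁ (x∈B , _) = x∈B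
  ...   | inj₂ refl      = ⊥-elim (x≢i refl)
  B⊆B″ : ∀ {x} → x ∈ B → x ∈ exch i j (exch j i B)
  B⊆B″ {x} x∈B with x ≟ j
  ... | yes refl = j∈exch
  ... | no x≢j   = ∈-exch⁺ (∈-exch⁺ x∈B x≢j) (λ { refl → i∉B x∈B })

-- The matroid represented by M

δ : ∀ {n} → Fin n → Fin n → ℤω
δ j e with e ≟ j
... | yes _ = 1ω
... | no _  = 0ω

δ-≡ : ∀ {n} (j : Fin n) → δ j j ≡ 1ω
δ-≡ j with j ≟ j
... | yes _   = refl
... | no j≢j  = ⊥-elim (j≢j refl)

δ-≢ : ∀ {n} {j e : Fin n} → e ≢ j → δ j e ≡ 0ω
δ-≢ {j = j} {e} e≢j with e ≟ j
... | yes e≡j = ⊥-elim (e≢j e≡j)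
... | no _    = refl

δ-supported : ∀ {n} {S : Subset n} {j} → j ∈ S → SupportedOn S (δ j)
δ-supported j∈S e e∉S = δ-≢ (λ { refl → e∉S j∈S })

module _ {r n} (M : Matrix r n) where

  combo-δ : ∀ j x → combo M (δ j) x ≡ M x j
  combo-δ j x = begin
    combo M (δ j) x
      ≡⟨ Σ-single (λ e → δ j e *ω M x e) j (λ e e≢j → trans (cong (_*ω M x e) (δ-≢ e≢j)) (*ω-zeroˡ (M x e))) ⟩
    δ j j *ω M x j   ≡⟨ cong (_*ω M x j) (δ-≡ j) ⟩
    1ω *ω M x j      ≡⟨ *ω-identityˡ (M x j) ⟩
    M x j            ∎
    where open ≡-Reasoning

  Independent-unique : ∀ {S} → Independent M S → ∀ {c d} → SupportedOn S c → SupportedOn S d →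
                       (∀ x → combo M c x ≡ combo M d x) → ∀ e → c e ≡ d e
  Independent-unique {S} ind {c} {d} c-supp d-supp Mc≡Md e =
    trans (split (c e) (d e)) (trans (cong (_+ω d e) (ind g g-supp Mg≡0 e)) (+ω-identityˡ (d e)))
    where
    g = λ e → 1ω *ω c e +ω (-ω 1ω) *ω d e
    split : ∀ a b → a ≡ (1ω *ω a +ω (-ω 1ω) *ω b) +ω b
    split = solve-∀ ℤω-ring
    cancel : ∀ a → 1ω *ω a +ω (-ω 1ω) *ω a ≡ 0ω
    cancel = solve-∀ ℤω-ring
    g-supp : SupportedOn S g
    g-supp e e∉S = trans (cong₂ (λ u v → 1ω *ω u +ω (-ω 1ω) *ω v) (c-supp e e∉S) (d-supp e e∉S)) (cancel 0ω)
    Mg≡0 : ∀ x → combo M g x ≡ 0ω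
    Mg≡0 x = trans (combo-linear M 1ω (-ω 1ω) c d x)
                   (trans (cong (λ z → 1ω *ω z +ω (-ω 1ω) *ω combo M d x) (Mc≡Md x)) (cancel (combo M d x)))

  Independent-⊆ : ∀ {S T} → S ⊆ T → Independent M T → Independent M S
  Independent-⊆ {S} {T} S⊆T ind c c-supp Mc≡0 = ind c T-supp Mc≡0
    where
    T-supp : SupportedOn T c
    T-supp e e∉T with e ∈? S
    ... | yes e∈S = ⊥-elim (e∉T (S⊆T e∈S))
    ... | no e∉S  = c-supp e e∉S

  -- A dependence l of the columns of M listed by enum S is the dependence Σₜ lₜ δ_{enum S t} on S.
  Independent⇒¬dependent : ∀ {S} → Independent M S → ¬ ColumnsDependent (columns M (enum S))
  Independent⇒¬dependent {S} ind (l , Ml≡0 , t₀ , lt₀≢0) =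
    lt₀≢0 (trans (sym (c-enum t₀)) (ind c c-supp Mc≡0 (enum S t₀)))
    where
    c : Fin n → ℤω
    c e = Σ[ (λ t → δ (enum S t) e *ω l t) ]
    enum-inj = StrictlyIncreasing⇒Injective (enum S) (enum-increasing S)
    c-enum : ∀ t → c (enum S t) ≡ l t
    c-enum t = trans (Σ-single (λ t′ → δ (enum S t′) (enum S t) *ω l t′) t
                        (λ t′ t′≢t → trans (cong (_*ω l t′) (δ-≢ (t′≢t ∘ sym ∘ enum-inj))) (*ω-zeroˡ (l t′))))
                     (trans (cong (_*ω l t) (δ-≡ (enum S t))) (*ω-identityˡ (l t)))
    c-supp : SupportedOn S c
    c-supp e e∉S = Σ-zero (λ t → δ (enum S t) e *ω l t)
      (λ t → trans (cong (_*ω l t) (δ-supported (enum-∈ S t) e e∉S)) (*ω-zeroˡ (l t)))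
    Mc≡0 : ∀ x → combo M c x ≡ 0ω
    Mc≡0 x = begin
      combo M c x
        ≡⟨ Σ-enum S (λ e → c e *ω M x e) (λ e e∉S → trans (cong (_*ω M x e) (c-supp e e∉S)) (*ω-zeroˡ (M x e))) ⟩
      Σ[ (λ t → c (enum S t) *ω M x (enum S t)) ]
        ≡⟨ Σ-cong (λ t → cong (_*ω M x (enum S t)) (c-enum t)) ⟩
      combo (columns M (enum S)) l x
        ≡⟨ Ml≡0 x ⟩
      0ω ∎
      where open ≡-Reasoning

  Independent⇒∣∣≤ : ∀ {S} → Independent M S → ∣ S ∣ ℕ.≤ r
  Independent⇒∣∣≤ {S} ind = ℕₚ.≮⇒≥
    (λ r<∣S∣ → Independent⇒¬dependent ind (dependent-if-wide r r<∣S∣ (columns M (enum S))))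

  rowCombo : (Fin r → ℤω) → Fin n → ℤω
  rowCombo y e = Σ[ (λ x → y x *ω M x e) ]

  Independent-∪ : ∀ {B e} → Independent M B → ∀ y → (∀ b → b ∈ B → rowCombo y b ≡ 0ω) →
                  rowCombo y e ≢ 0ω → Independent M (B ∪ ⁅ e ⁆)
  Independent-∪ {B} {e} ind y yM[B]≡0 yMe≢0 d d-supp Md≡0 = ind d d-suppB Md≡0
    where
    off-e : ∀ f → f ≢ e → d f *ω rowCombo y f ≡ 0ω
    off-e f f≢e with f ∈? B
    ... | yes f∈B = trans (cong (d f *ω_) (yM[B]≡0 f f∈B)) (*ω-zeroʳ (d f))
    ... | no f∉B  = trans (cong (_*ω rowCombo y f) (d-supp f (∉∪⁅⁆ f∉B f≢e))) (*ω-zeroˡ (rowCombo y f))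
    yMe*de≡0 : rowCombo y e *ω d e ≡ 0ω
    yMe*de≡0 = begin
      rowCombo y e *ω d e                  ≡⟨ *ω-comm (rowCombo y e) (d e) ⟩
      d e *ω rowCombo y e                  ≡⟨ Σ-single (λ f → d f *ω rowCombo y f) e off-e ⟨
      Σ[ (λ f → d f *ω rowCombo y f) ]     ≡⟨ Σ-combo-transpose M y d ⟨
      Σ[ (λ x → y x *ω combo M d x) ]
        ≡⟨ Σ-zero (λ x → y x *ω combo M d x) (λ x → trans (cong (y x *ω_) (Md≡0 x)) (*ω-zeroʳ (y x))) ⟩
      0ω                                   ∎
      where open ≡-Reasoning
    d-suppB : SupportedOn B d
    d-suppB f f∉B with f ≟ e
    ... | yes refl = xy≡0∧x≢0⇒y≡0 yMe*de≡0 yMe≢0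
    ... | no f≢e   = d-supp f (∉∪⁅⁆ f∉B f≢e)

  basis-rowCombo : ∀ {B} → IsBasis M B → ∀ y → (∀ b → b ∈ B → rowCombo y b ≡ 0ω) → ∀ e → rowCombo y e ≡ 0ω
  basis-rowCombo {B} (ind , maximal) y yM[B]≡0 e with e ∈? B | rowCombo y e ≟ω 0ω
  ... | yes e∈B | _         = yM[B]≡0 e e∈B
  ... | no _    | yes yMe≡0 = yMe≡0
  ... | no e∉B  | no yMe≢0  = ⊥-elim (maximal e e∉B (Independent-∪ ind y yM[B]≡0 yMe≢0))

  -- A dependence l of [δ x₀ ∣ M[B₀]] has l₀ ≠ 0 since B₀ is independent,
  -- and 0 = yᵀ [δ x₀ ∣ M[B₀]] l = l₀ y x₀.
  rowCombo≡0⇒≡0 : ∀ {B₀} → Independent M B₀ → ∣ B₀ ∣ ≡ r →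
                  ∀ y → (∀ e → rowCombo y e ≡ 0ω) → ∀ x₀ → y x₀ ≡ 0ω
  rowCombo≡0⇒≡0 {B₀} ind₀ ∣B₀∣≡r y yM≡0 x₀ =
    from-dependence (dependent-if-wide r (subst (r ℕ.<_) (cong suc (sym ∣B₀∣≡r)) (ℕₚ.n<1+n r)) P)
    where
    P : Matrix r (suc ∣ B₀ ∣)
    P x zero    = δ x₀ x
    P x (suc t) = M x (enum B₀ t)
    yᵀP≡ : Σ[ (λ x → y x *ω δ x₀ x) ] ≡ y x₀
    yᵀP≡ = trans (Σ-single (λ x → y x *ω δ x₀ x) x₀
                    (λ x x≢x₀ → trans (cong (y x *ω_) (δ-≢ x≢x₀)) (*ω-zeroʳ (y x))))
                 (trans (cong (y x₀ *ω_) (δ-≡ x₀)) (trans (*ω-comm (y x₀) 1ω) (*ω-identityˡ (y x₀))))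
    from-dependence : ColumnsDependent P → y x₀ ≡ 0ω
    from-dependence (l , Pl≡0 , t₀ , lt₀≢0) with l zero ≟ω 0ω
    ... | yes l₀≡0 = ⊥-elim (Independent⇒¬dependent ind₀ (l ∘ suc , M[B₀]l≡0 , nonzero t₀ lt₀≢0))
      where
      nonzero : ∀ t → l t ≢ 0ω → ∃ λ t′ → l (suc t′) ≢ 0ω
      nonzero zero    l₀≢0 = ⊥-elim (l₀≢0 l₀≡0)
      nonzero (suc t) lt≢0 = t , lt≢0
      M[B₀]l≡0 : ∀ x → combo (columns M (enum B₀)) (l ∘ suc) x ≡ 0ω
      M[B₀]l≡0 x = begin
        combo (columns M (enum B₀)) (l ∘ suc) x
          ≡⟨ +ω-identityˡ (combo (columns M (enum B₀)) (l ∘ suc) x) ⟨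
        0ω +ω combo (columns M (enum B₀)) (l ∘ suc) x
          ≡⟨ cong (_+ω combo (columns M (enum B₀)) (l ∘ suc) x) (*ω-zeroˡ (δ x₀ x)) ⟨
        0ω *ω δ x₀ x +ω combo (columns M (enum B₀)) (l ∘ suc) x
          ≡⟨ cong (λ z → z *ω δ x₀ x +ω combo (columns M (enum B₀)) (l ∘ suc) x) l₀≡0 ⟨
        combo P l x
          ≡⟨ Pl≡0 x ⟩
        0ω ∎
        where open ≡-Reasoning
    ... | no l₀≢0 = xy≡0∧x≢0⇒y≡0 l₀yx₀≡0 l₀≢0
      where
      yᵀM[B₀]≡0 : ∀ t → l (suc t) *ω rowCombo y (enum B₀ t) ≡ 0ω
      yᵀM[B₀]≡0 t = trans (cong (l (suc t) *ω_) (yM≡0 (enum B₀ t))) (*ω-zeroʳ (l (suc t)))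
      l₀yx₀≡0 : l zero *ω y x₀ ≡ 0ω
      l₀yx₀≡0 = begin
        l zero *ω y x₀
          ≡⟨ +ω-identityʳ (l zero *ω y x₀) ⟨
        l zero *ω y x₀ +ω 0ω
          ≡⟨ cong₂ (λ a b → l zero *ω a +ω b) yᵀP≡ (Σ-zero (λ t → l (suc t) *ω rowCombo y (enum B₀ t)) yᵀM[B₀]≡0) ⟨
        Σ[ (λ t → l t *ω combo (λ t x → P x t) y t) ]
          ≡⟨ Σ-combo-transpose P y l ⟨
        Σ[ (λ x → y x *ω combo P l x) ]
          ≡⟨ Σ-zero (λ x → y x *ω combo P l x) (λ x → trans (cong (y x *ω_) (Pl≡0 x)) (*ω-zeroʳ (y x))) ⟩
        0ω ∎
        where open ≡-Reasoning

  -- If ∣ B ∣ < r, Steinitz gives y ≠ 0 with yᵀ M[B] = 0, and then yᵀ M = 0.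
  basis-size : ∀ {B B₀} → IsBasis M B → IsBasis M B₀ → ∣ B₀ ∣ ≡ r → ∣ B ∣ ≡ r
  basis-size {B} basis (ind₀ , _) ∣B₀∣≡r = ℕₚ.≤-antisym (Independent⇒∣∣≤ (proj₁ basis)) (ℕₚ.≮⇒≥ ∣B∣≮r)
    where
    from-dependence : ColumnsDependent (λ t x → M x (enum B t)) → ⊥
    from-dependence (y , yM[B]≡0 , x₀ , yx₀≢0) =
      yx₀≢0 (rowCombo≡0⇒≡0 ind₀ ∣B₀∣≡r y (basis-rowCombo basis y yM[b]≡0) x₀)
      where
      yM[b]≡0 : ∀ b → b ∈ B → rowCombo y b ≡ 0ω
      yM[b]≡0 b b∈B = subst (λ e → rowCombo y e ≡ 0ω) (proj₂ (enum-surjective B b∈B))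
                            (yM[B]≡0 (proj₁ (enum-surjective B b∈B)))
    ∣B∣≮r : ¬ ∣ B ∣ ℕ.< r
    ∣B∣≮r ∣B∣<r = from-dependence (dependent-if-wide ∣ B ∣ ∣B∣<r (λ t x → M x (enum B t)))

  -- c - δ j: when c is the column of M_B for j, this is the fundamental circuit of j over B.
  circuit : (Fin n → ℤω) → Fin n → Fin n → ℤω
  circuit c j e = 1ω *ω c e +ω (-ω 1ω) *ω δ j e

  circuit-≢ : ∀ c {i j} → i ≢ j → circuit c j i ≡ c i
  circuit-≢ c {i} i≢j = trans (cong (λ a → 1ω *ω c i +ω (-ω 1ω) *ω a) (δ-≢ i≢j)) (simplify (c i))
    where
    simplify : ∀ a → 1ω *ω a +ω (-ω 1ω) *ω 0ω ≡ a
    simplify = solve-∀ ℤω-ring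

  circuit-≡ : ∀ c j → c j ≡ 0ω → circuit c j j ≡ -ω 1ω
  circuit-≡ c j cj≡0 = cong₂ (λ a b → 1ω *ω a +ω (-ω 1ω) *ω b) cj≡0 (δ-≡ j)

  circuit-supported : ∀ {B} c j → SupportedOn B c → ∀ e → e ∉ B → e ≢ j → circuit c j e ≡ 0ω
  circuit-supported c j c-supp e e∉B e≢j = cong₂ (λ a b → 1ω *ω a +ω (-ω 1ω) *ω b) (c-supp e e∉B) (δ-≢ e≢j)

  combo-circuit : ∀ c j → (∀ x → combo M c x ≡ M x j) → ∀ x → combo M (circuit c j) x ≡ 0ω
  combo-circuit c j Mc≡Mj x = begin
    combo M (circuit c j) x                          ≡⟨ combo-linear M 1ω (-ω 1ω) c (δ j) x ⟩
    1ω *ω combo M c x +ω (-ω 1ω) *ω combo M (δ j) x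
      ≡⟨ cong₂ (λ a b → 1ω *ω a +ω (-ω 1ω) *ω b) (Mc≡Mj x) (combo-δ j x) ⟩
    1ω *ω M x j +ω (-ω 1ω) *ω M x j                  ≡⟨ cancel (M x j) ⟩
    0ω                                               ∎
    where
    open ≡-Reasoning
    cancel : ∀ a → 1ω *ω a +ω (-ω 1ω) *ω a ≡ 0ω
    cancel = solve-∀ ℤω-ring

  -- If j ∈ B, the column of M_B for j is δ j, whose entry at i ≠ j is 0.
  Good⇒∉ : ∀ {B i j} → i ≢ j → Good M i j B → j ∉ B
  Good⇒∉ {B} {i} {j} i≢j ((ind , _) , _ , z , (c , (c-supp , Mc≡Mj) , ci≡z) , z≢0) j∈B =
    z≢0 (trans (sym ci≡z) (trans (Independent-unique ind c-supp (δ-supported j∈B)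
                                   (λ x → trans (Mc≡Mj x) (sym (combo-δ j x))) i)
                                 (δ-≢ i≢j)))

  -- For d supported on exch i j S with M d = 0, g = u j · d - d j · u is supported on S, so g = 0;
  -- reading g at i gives d j · u i = 0, hence d j = 0 and d is supported on S.
  Independent-exch : ∀ {S i j} → Independent M S → i ∈ S → j ∉ S → (u : Fin n → ℤω) →
                     (∀ e → e ∉ S → e ≢ j → u e ≡ 0ω) → (∀ x → combo M u x ≡ 0ω) → u i ≢ 0ω →
                     Independent M (exch i j S)
  Independent-exch {S} {i} {j} ind i∈S j∉S u u-supp Mu≡0 ui≢0 d d-supp Md≡0 = ind d d-suppS Md≡0
    where
    i≢j : i ≢ j
    i≢j refl = j∉S i∈S
    ∉exch : ∀ {e} → e ∉ S → e ≢ j → e ∉ exch i j S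
    ∉exch e∉S e≢j e∈ with ∈-exch⁻ e∈
    ... | inj₁ (e∈S , _) = e∉S e∈S
    ... | inj₂ e≡j       = e≢j e≡j
    g = λ e → u j *ω d e +ω (-ω d j) *ω u e
    Mg≡0 : ∀ x → combo M g x ≡ 0ω
    Mg≡0 x = trans (combo-linear M (u j) (-ω d j) d u x)
      (trans (cong₂ (λ a b → u j *ω a +ω (-ω d j) *ω b) (Md≡0 x) (Mu≡0 x))
             (cong₂ _+ω_ (*ω-zeroʳ (u j)) (*ω-zeroʳ (-ω d j))))
    g-supp : SupportedOn S g
    g-supp e e∉S with e ≟ j
    ... | yes refl = cancel (u e) (d e)
      where
      cancel : ∀ a b → a *ω b +ω (-ω b) *ω a ≡ 0ω
      cancel = solve-∀ ℤω-ring
    ... | no e≢j = trans (cong₂ (λ a b → u j *ω a +ω (-ω d j) *ω b) (d-supp e (∉exch e∉S e≢j)) (u-supp e e∉S e≢j))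
                         (cong₂ _+ω_ (*ω-zeroʳ (u j)) (*ω-zeroʳ (-ω d j)))
    di≡0 : d i ≡ 0ω
    di≡0 = d-supp i (i∉exch i≢j)
    -dj*ui≡0 : (-ω d j) *ω u i ≡ 0ω
    -dj*ui≡0 = begin
      (-ω d j) *ω u i                         ≡⟨ +ω-identityˡ ((-ω d j) *ω u i) ⟨
      0ω +ω (-ω d j) *ω u i                   ≡⟨ cong (_+ω (-ω d j) *ω u i) (*ω-zeroʳ (u j)) ⟨
      u j *ω 0ω +ω (-ω d j) *ω u i            ≡⟨ cong (λ a → u j *ω a +ω (-ω d j) *ω u i) di≡0 ⟨
      g i                                     ≡⟨ ind g g-supp Mg≡0 i ⟩
      0ω                                      ∎
      where open ≡-Reasoning
    dj≡0 : d j ≡ 0ω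
    dj≡0 = -ω≡0ω⇒≡0ω (d j) (xy≡0∧x≢0⇒y≡0 (trans (*ω-comm (u i) (-ω d j)) -dj*ui≡0) ui≢0)
    d-suppS : SupportedOn S d
    d-suppS e e∉S with e ≟ j
    ... | yes refl = dj≡0
    ... | no e≢j   = d-supp e (∉exch e∉S e≢j)

  -- If B ∪ {e} were independent for e ∉ B′ = exch i j B, then either e = i and the circuit
  -- (supported on B′ ∪ {i}, nonzero at j) is a dependence, or e ≠ i and exchanging j back for i
  -- gives an independent superset of B ∪ {e}.
  IsBasis-exch : ∀ {B i j} → IsBasis M B → i ∈ B → j ∉ B → ∀ c → IsColOfMB M B j c → c i ≢ 0ω →
                 IsBasis M (exch i j B)
  IsBasis-exch {B} {i} {j} (ind , maximal) i∈B j∉B c (c-supp , Mc≡Mj) ci≢0 = ind′ , maximal′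
    where
    i≢j : i ≢ j
    i≢j refl = j∉B i∈B
    u = circuit c j
    u-supp = circuit-supported c j c-supp
    Mu≡0 = combo-circuit c j Mc≡Mj
    uj≢0 : u j ≢ 0ω
    uj≢0 uj≡0 with trans (sym (circuit-≡ c j (c-supp j j∉B))) uj≡0
    ... | ()
    ind′ : Independent M (exch i j B)
    ind′ = Independent-exch ind i∈B j∉B u u-supp Mu≡0 (λ ui≡0 → ci≢0 (trans (sym (circuit-≢ c i≢j)) ui≡0))
    maximal-i : ¬ Independent M (exch i j B ∪ ⁅ i ⁆)
    maximal-i indT = uj≢0 (indT u u-suppT Mu≡0 j)
      where
      u-suppT : SupportedOn (exch i j B ∪ ⁅ i ⁆) u
      u-suppT e e∉T = u-supp e e∉B (λ { refl → e∉T (∈∪⁅⁆ˡ j∈exch) })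
        where
        e∉B : e ∉ B
        e∉B e∈B with e ≟ i
        ... | yes refl = e∉T ∈∪⁅⁆ʳ
        ... | no e≢i   = e∉T (∈∪⁅⁆ˡ (∈-exch⁺ e∈B e≢i))
    maximal-≢i : ∀ {e} → e ∉ exch i j B → e ≢ i → ¬ Independent M (exch i j B ∪ ⁅ e ⁆)
    maximal-≢i {e} e∉B′ e≢i indT =
      maximal e e∉B (Independent-⊆ B∪e⊆ (Independent-exch indT (∈∪⁅⁆ˡ j∈exch) i∉T u u-suppT Mu≡0 uj≢0))
      where
      T = exch i j B ∪ ⁅ e ⁆
      e∉B : e ∉ B
      e∉B e∈B = e∉B′ (∈-exch⁺ e∈B e≢i)
      i∉T : i ∉ T
      i∉T i∈T with ∈∪⁅⁆⁻ i∈T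
      ... | inj₁ i∈B′ = i∉exch i≢j i∈B′
      ... | inj₂ i≡e  = e≢i (sym i≡e)
      u-suppT : ∀ e′ → e′ ∉ T → e′ ≢ i → u e′ ≡ 0ω
      u-suppT e′ e′∉T e′≢i = u-supp e′ (λ e′∈B → e′∉T (∈∪⁅⁆ˡ (∈-exch⁺ e′∈B e′≢i)))
        (λ { refl → e′∉T (∈∪⁅⁆ˡ j∈exch) })
      B∪e⊆ : B ∪ ⁅ e ⁆ ⊆ exch j i T
      B∪e⊆ {x} x∈ with ∈∪⁅⁆⁻ x∈ | x ≟ i
      ... | inj₁ x∈B | yes refl = j∈exch
      ... | inj₁ x∈B | no x≢i   = ∈-exch⁺ (∈∪⁅⁆ˡ (∈-exch⁺ x∈B x≢i)) (λ { refl → j∉B x∈B })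
      ... | inj₂ refl | _       = ∈-exch⁺ ∈∪⁅⁆ʳ (λ { refl → e∉B′ j∈exch })
    maximal′ : ∀ e → e ∉ exch i j B → ¬ Independent M (exch i j B ∪ ⁅ e ⁆)
    maximal′ e e∉B′ with e ≟ i
    ... | yes refl = maximal-i
    ... | no e≢i   = maximal-≢i e∉B′ e≢i

  -- For c i · w = 1 this is w · (c i · δ i - circuit c j), the column of M_{exch i j B} for i.
  exch-column : (Fin n → ℤω) → Fin n → Fin n → ℤω → Fin n → ℤω
  exch-column c i j w e = (-ω w) *ω circuit c j e +ω (w *ω c i) *ω δ i e

  exch-column-supported : ∀ {B i j} c w → i ≢ j → SupportedOn B c → SupportedOn (exch i j B) (exch-column c i j w)
  exch-column-supported {B} {i} {j} c w i≢j c-supp e e∉B′ = by-cases (e ≟ i)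
    where
    by-cases : Dec (e ≡ i) → exch-column c i j w e ≡ 0ω
    by-cases (yes refl) = begin
      (-ω w) *ω circuit c j e +ω (w *ω c e) *ω δ e e
        ≡⟨ cong₂ (λ a b → (-ω w) *ω a +ω (w *ω c e) *ω b) (circuit-≢ c i≢j) (δ-≡ e) ⟩
      (-ω w) *ω c e +ω (w *ω c e) *ω 1ω
        ≡⟨ cancel w (c e) ⟩
      0ω ∎
      where
      open ≡-Reasoning
      cancel : ∀ w a → (-ω w) *ω a +ω (w *ω a) *ω 1ω ≡ 0ω
      cancel = solve-∀ ℤω-ring
    by-cases (no e≢i) = begin
      (-ω w) *ω circuit c j e +ω (w *ω c i) *ω δ i e
        ≡⟨ cong₂ (λ a b → (-ω w) *ω a +ω (w *ω c i) *ω b) ue≡0 (δ-≢ e≢i) ⟩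
      (-ω w) *ω 0ω +ω (w *ω c i) *ω 0ω
        ≡⟨ cong₂ _+ω_ (*ω-zeroʳ (-ω w)) (*ω-zeroʳ (w *ω c i)) ⟩
      0ω ∎
      where
      open ≡-Reasoning
      ue≡0 : circuit c j e ≡ 0ω
      ue≡0 = circuit-supported c j c-supp e (λ e∈B → e∉B′ (∈-exch⁺ e∈B e≢i)) (λ { refl → e∉B′ j∈exch })

  combo-exch-column : ∀ c {i j} w → (∀ x → combo M c x ≡ M x j) → c i *ω w ≡ 1ω →
                      ∀ x → combo M (exch-column c i j w) x ≡ M x i
  combo-exch-column c {i} {j} w Mc≡Mj ci*w≡1 x = begin
    combo M (exch-column c i j w) x
      ≡⟨ combo-linear M (-ω w) (w *ω c i) (circuit c j) (δ i) x ⟩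
    (-ω w) *ω combo M (circuit c j) x +ω (w *ω c i) *ω combo M (δ i) x
      ≡⟨ cong₂ (λ a b → (-ω w) *ω a +ω (w *ω c i) *ω b) (combo-circuit c j Mc≡Mj x) (combo-δ i x) ⟩
    (-ω w) *ω 0ω +ω (w *ω c i) *ω M x i
      ≡⟨ cong₂ (λ a b → a +ω b *ω M x i) (*ω-zeroʳ (-ω w)) (trans (*ω-comm w (c i)) ci*w≡1) ⟩
    0ω +ω 1ω *ω M x i
      ≡⟨ trans (+ω-identityˡ (1ω *ω M x i)) (*ω-identityˡ (M x i)) ⟩
    M x i ∎
    where open ≡-Reasoning

  exch-column-j : ∀ c {i j} w → i ≢ j → c j ≡ 0ω → exch-column c i j w j ≡ w
  exch-column-j c {i} {j} w i≢j cj≡0 = begin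
    (-ω w) *ω circuit c j j +ω (w *ω c i) *ω δ i j
      ≡⟨ cong₂ (λ a b → (-ω w) *ω a +ω (w *ω c i) *ω b) (circuit-≡ c j cj≡0) (δ-≢ (i≢j ∘ sym)) ⟩
    (-ω w) *ω (-ω 1ω) +ω (w *ω c i) *ω 0ω
      ≡⟨ simplify w (w *ω c i) ⟩
    w ∎
    where
    open ≡-Reasoning
    simplify : ∀ w a → (-ω w) *ω (-ω 1ω) +ω a *ω 0ω ≡ w
    simplify = solve-∀ ℤω-ring

  Good-exch-from-inverse : ∀ {B i j} → i ≢ j → IsBasis M B → i ∈ B → j ∉ B →
                           ∀ c → IsColOfMB M B j c → c i ≢ 0ω → ∀ w → c i *ω w ≡ 1ω →
                           Good M j i (exch i j B)
  Good-exch-from-inverse {B} {i} {j} i≢j basis i∈B j∉B c col@(c-supp , Mc≡Mj) ci≢0 w ci*w≡1 =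
    IsBasis-exch basis i∈B j∉B c col ci≢0 , j∈exch , w ,
    (exch-column c i j w ,
      (exch-column-supported c w i≢j c-supp , combo-exch-column c w Mc≡Mj ci*w≡1) ,
      exch-column-j c w i≢j (c-supp j j∉B)) ,
    w≢0
    where
    w≢0 : w ≢ 0ω
    w≢0 w≡0 with trans (sym ci*w≡1) (trans (cong (c i *ω_) w≡0) (*ω-zeroʳ (c i)))
    ... | ()

  -- On j the circuit cancels c′ j = w; elsewhere outside B both vanish.
  exch-back-supported : ∀ {B i j} c c′ w → SupportedOn B c → c j ≡ 0ω → SupportedOn (exch i j B) c′ → c′ j ≡ w →
                        SupportedOn B (λ e → 1ω *ω c′ e +ω w *ω circuit c j e)
  exch-back-supported {B} {i} {j} c c′ w c-supp cj≡0 c′-supp c′j≡w e e∉B = by-cases (e ≟ j)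
    where
    by-cases : Dec (e ≡ j) → 1ω *ω c′ e +ω w *ω circuit c j e ≡ 0ω
    by-cases (yes refl) = begin
      1ω *ω c′ e +ω w *ω circuit c e e  ≡⟨ cong₂ (λ a b → 1ω *ω a +ω w *ω b) c′j≡w (circuit-≡ c e cj≡0) ⟩
      1ω *ω w +ω w *ω (-ω 1ω)           ≡⟨ cancel w ⟩
      0ω                                ∎
      where
      open ≡-Reasoning
      cancel : ∀ w → 1ω *ω w +ω w *ω (-ω 1ω) ≡ 0ω
      cancel = solve-∀ ℤω-ring
    by-cases (no e≢j) = begin
      1ω *ω c′ e +ω w *ω circuit c j e
        ≡⟨ cong₂ (λ a b → 1ω *ω a +ω w *ω b) (c′-supp e e∉B′) (circuit-supported c j c-supp e e∉B e≢j) ⟩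
      1ω *ω 0ω +ω w *ω 0ω
        ≡⟨ cong₂ _+ω_ (*ω-zeroʳ 1ω) (*ω-zeroʳ w) ⟩
      0ω ∎
      where
      open ≡-Reasoning
      e∉B′ : e ∉ exch i j B
      e∉B′ e∈B′ = [ (λ (e∈B , _) → e∉B e∈B) , e≢j ]′ (∈-exch⁻ e∈B′)

  -- c′ + w · circuit c j is supported on B and represents M[i], so it is δ i; its entry at i is w · z.
  fB-exch-inverse : ∀ {B i j} → i ≢ j → Good M i j B → ∀ {z w} → fB≡ M B i j z
                    → fB≡ M (exch i j B) j i w → z *ω w ≡ 1ω
  fB-exch-inverse {B} {i} {j} i≢j good@((ind , _) , i∈B , _) {z} {w}
                  (c , (c-supp , Mc≡Mj) , ci≡z) (c′ , (c′-supp , Mc′≡Mi) , c′j≡w) = begin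
    z *ω w                  ≡⟨ *ω-comm z w ⟩
    w *ω z                  ≡⟨ +ω-identityˡ (w *ω z) ⟨
    0ω +ω w *ω z            ≡⟨ cong (_+ω w *ω z) (*ω-zeroʳ 1ω) ⟨
    1ω *ω 0ω +ω w *ω z      ≡⟨ cong₂ (λ a b → 1ω *ω a +ω w *ω b) (sym c′i≡0)
                                        (trans (sym ci≡z) (sym (circuit-≢ c i≢j))) ⟩
    g i                     ≡⟨ Independent-unique ind g-supp (δ-supported i∈B) Mg≡Mδ i ⟩
    δ i i                   ≡⟨ δ-≡ i ⟩
    1ω                      ∎
    where
    open ≡-Reasoning
    u = circuit c j
    g = λ e → 1ω *ω c′ e +ω w *ω u e
    c′i≡0 : c′ i ≡ 0ω
    c′i≡0 = c′-supp i (i∉exch i≢j)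
    g-supp : SupportedOn B g
    g-supp = exch-back-supported c c′ w c-supp (c-supp j (Good⇒∉ i≢j good)) c′-supp c′j≡w
    Mg≡Mδ : ∀ x → combo M g x ≡ combo M (δ i) x
    Mg≡Mδ x = begin
      combo M g x                                   ≡⟨ combo-linear M 1ω w c′ u x ⟩
      1ω *ω combo M c′ x +ω w *ω combo M u x        ≡⟨ cong₂ (λ a b → 1ω *ω a +ω w *ω b) (Mc′≡Mi x)
                                                                                       (combo-circuit c j Mc≡Mj x) ⟩
      1ω *ω M x i +ω w *ω 0ω                        ≡⟨ cong₂ _+ω_ (*ω-identityˡ (M x i)) (*ω-zeroʳ w) ⟩
      M x i +ω 0ω                                   ≡⟨ +ω-identityʳ (M x i) ⟩
      M x i                                         ≡⟨ combo-δ i x ⟨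
      combo M (δ i) x                               ∎

-- Cramer: with M[B] square, replacing the column of i by that of j multiplies det M[B] by c i.
-- Both determinants are nonzero elements of ℍ, hence units.
fB-invertible : ∀ {r n} (M : Matrix r n) → IsℍMatrix M → ∀ {B i j} → ∣ B ∣ ≡ r → Independent M B →
                i ∈ B → j ∉ B → ∀ c → IsColOfMB M B j c → c i ≢ 0ω → ∃ λ w → c i *ω w ≡ 1ω
fB-invertible M hM {B} {i} {j} refl ind i∈B j∉B c (c-supp , Mc≡Mj) ci≢0 =
  D *ω conj (c i *ω D) , trans (sym (*ω-assoc (c i) D (conj (c i *ω D)))) (Inℍ-*ω-conj ciD∈ℍ ciD≢0)
  where
  κ = enum B
  A = columns M κ
  D = det A
  D≢0 : D ≢ 0ω
  D≢0 D≡0 = Independent⇒¬dependent M ind (det≡0⇒dependent A D≡0)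
  ciD≢0 : c i *ω D ≢ 0ω
  ciD≢0 ciD≡0 = D≢0 (xy≡0∧x≢0⇒y≡0 ciD≡0 ci≢0)
  p = proj₁ (enum-surjective B i∈B)
  κp≡i : κ p ≡ i
  κp≡i = proj₂ (enum-surjective B i∈B)
  κ′ = updateAt κ p (λ _ → j)
  κ′-≢ : ∀ {b} → b ≢ p → κ′ b ≡ κ b
  κ′-≢ {b} b≢p = updateAt-minimal b p κ b≢p
  κ′-injective : Injective _≡_ _≡_ κ′
  κ′-injective = updateAt-injective κ (StrictlyIncreasing⇒Injective κ (enum-increasing B)) p
                   (λ t κt≡j → j∉B (subst (_∈ B) κt≡j (enum-∈ B t)))
  M[κ′]≡ : ∀ x b → columns M κ′ x b ≡ setColumn p (combo A (c ∘ κ)) A x b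
  M[κ′]≡ x b with b ≟ p
  ... | yes refl = begin
    M x (κ′ b)                 ≡⟨ cong (M x) (updateAt-updates b κ) ⟩
    M x j                      ≡⟨ Mc≡Mj x ⟨
    combo M c x
      ≡⟨ Σ-enum B (λ e → c e *ω M x e) (λ e e∉B → trans (cong (_*ω M x e) (c-supp e e∉B)) (*ω-zeroˡ (M x e))) ⟩
    combo A (c ∘ κ) x          ≡⟨ setColumn-≡ b (combo A (c ∘ κ)) A x ⟨
    setColumn b (combo A (c ∘ κ)) A x b ∎
    where open ≡-Reasoning
  ... | no b≢p = trans (cong (M x) (κ′-≢ b≢p)) (sym (setColumn-≢ p (combo A (c ∘ κ)) A x b≢p))
  det[κ′]≡ : det (columns M κ′) ≡ c i *ω D
  det[κ′]≡ = trans (det-cong M[κ′]≡) (trans (cramer A p (c ∘ κ)) (cong (λ e → c e *ω D) κp≡i))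
  ciD∈ℍ : Inℍ (c i *ω D)
  ciD∈ℍ = subst Inℍ det[κ′]≡
    (Inℍ-det-injective M (λ σ σ↑ → hM _ (λ a → a) σ (λ a b a<b → a<b) σ↑) κ′ κ′-injective)

Good⇒Good-exch : ∀ {r n} (M : Matrix r n) → IsℍMatrix M → HasRank M r →
                 ∀ {B i j} → i ≢ j → Good M i j B → Good M j i (exch i j B)
Good⇒Good-exch M hM (B₀ , basis₀ , ∣B₀∣≡r) {B} {i} {j} i≢j good@(basis , i∈B , z , (c , col , ci≡z) , z≢0)
  = Good-exch-from-inverse M i≢j basis i∈B j∉B c col ci≢0 (proj₁ unit) (proj₂ unit)
  where
  j∉B = Good⇒∉ M i≢j good
  ci≢0 : c i ≢ 0ω
  ci≢0 ci≡0 = z≢0 (trans (sym ci≡z) ci≡0)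
  unit = fB-invertible M hM (basis-size M basis basis₀ ∣B₀∣≡r) (proj₁ basis) i∈B j∉B c col ci≢0

lemma4p14 : ∀ (r n : ℕ) (M : Matrix r n) → IsℍMatrix M → HasRank M r →
    ∀ (i j : Fin n) → i ≢ j →
    ( (∀ B → Good M i j B → Good M j i (exch i j B))
    × (∀ B₁ B₂ → Good M i j B₁ → Good M i j B₂ → exch i j B₁ ≡ exch i j B₂ → B₁ ≡ B₂)
    × (∀ B′ → Good M j i B′ → ∃ λ B → Good M i j B × exch i j B ≡ B′) )
    × (∀ B → Good M i j B → ∀ z w → fB≡ M B i j z → fB≡ M (exch i j B) j i w → z ≡ conj w)
lemma4p14 r n M hM rank i j i≢j =
  ( (λ B → Good⇒Good-exch M hM rank i≢j)
  , (λ B₁ B₂ good₁ good₂ → exch-injective (i∈ good₁) (Good⇒∉ M i≢j good₁) (i∈ good₂) (Good⇒∉ M i≢j good₂))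
  , (λ B′ good′ → exch j i B′ , Good⇒Good-exch M hM rank j≢i good′ , exch-exch (i∈ good′) (Good⇒∉ M j≢i good′)) )
  , (λ B good z w fz fw → xy≡1⇒x≡conj[y] z w (fB-exch-inverse M i≢j good fz fw))
  where
  j≢i = i≢j ∘ sym
  i∈ : ∀ {i j B} → Good M i j B → i ∈ B
  i∈ (_ , i∈B , _) = i∈B
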